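{- Let $D$ be the formal derivative with respect to the grammar $G\colon x\to xy,\ y\to xz,\ z\to zw,\ w\to xz$, and let $\mathrm{Gen}(y,t)=\sum_{n\ge0}D^n(y)\,t^n/n!$. Writing $\Delta=\sqrt{(w+y)^2-4xz}$, we have $$\mathrm{Gen}(y,t)=y+\frac{ -2xz+2xz\,e^{t\Delta}}{w+y+\Delta-(w+y-\Delta)e^{t\Delta}},$$ as power series in $t$.
   Context: Let $x,y,z,w$ be commuting variables. The formal derivative $D$ is the linear operator on Laurent polynomials in $x,y,z,w$ with $D(uv)=uD(v)+vD(u)$, $D(c)=0$ for constants $c$, and $D(x)=xy$, $D(y)=xz$, $D(z)=zw$, $D(w)=xz$; $D^0$ is the identity. For a Laurent polynomial $u$, $\mathrm{Gen}(u,t)=\sum_{n\ge0}D^n(u)t^n/n!$. -}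

module Defs where

open import Data.Nat as ℕ using (ℕ; zero; suc)
open import Data.Nat.Combinatorics using (_C_)
open import Data.Integer as ℤ using (ℤ; +_; _+_; _*_; -_; _-_; 0ℤ; 1ℤ)
open import Data.Product using (_×_; _,_; proj₁; proj₂)
open import Data.List using (List; []; _∷_; _++_; concatMap; map; foldr; upTo)
open import Data.Bool using (if_then_else_)
open import Relation.Nullary using (does)
open import Relation.Binary.PropositionalEquality using (_≡_)

-- Laurent monomials x^a y^b z^c w^d  (exponents in ℤ)

record Mon : Set where
  constructor mon
  field ex ey ez ew : ℤ
open Mon public

_=ₘ_ : Mon → Mon → Data.Bool.Bool
mon a b c d =ₘ mon a' b' c' d' =
  does (a ℤ.≟ a') Data.Bool.∧ does (b ℤ.≟ b') Data.Bool.∧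
  does (c ℤ.≟ c') Data.Bool.∧ does (d ℤ.≟ d')

_·ₘ_ : Mon → Mon → Mon
mon a b c d ·ₘ mon a' b' c' d' = mon (a + a') (b + b') (c + c') (d + d')

-- Laurent polynomials in x,y,z,w with integer coefficients, as finite
-- formal sums of terms; two are equal iff all coefficients agree.

Poly : Set
Poly = List (ℤ × Mon)

coeff : Poly → Mon → ℤ
coeff []              m = 0ℤ
coeff ((c , m') ∷ p)  m = (if m' =ₘ m then c else 0ℤ) + coeff p m

_≈ₚ_ : Poly → Poly → Set
p ≈ₚ q = ∀ m → coeff p m ≡ coeff q m

cst : ℤ → Poly
cst c = (c , mon 0ℤ 0ℤ 0ℤ 0ℤ) ∷ []

X Y Z W : Poly
X = (1ℤ , mon 1ℤ 0ℤ 0ℤ 0ℤ) ∷ []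
Y = (1ℤ , mon 0ℤ 1ℤ 0ℤ 0ℤ) ∷ []
Z = (1ℤ , mon 0ℤ 0ℤ 1ℤ 0ℤ) ∷ []
W = (1ℤ , mon 0ℤ 0ℤ 0ℤ 1ℤ) ∷ []

_⊕_ : Poly → Poly → Poly
p ⊕ q = p ++ q

⊖_ : Poly → Poly
⊖ p = map (λ { (c , m) → (- c , m) }) p

_⊗_ : Poly → Poly → Poly
p ⊗ q = concatMap (λ { (c , m) → map (λ { (c' , m') → (c * c' , m ·ₘ m') }) q }) p

-- The formal derivative of the grammar x→xy, y→xz, z→zw, w→xz,
-- written out on a Laurent monomial via the Leibniz rule:
-- D(x^a y^b z^c w^d) = a x^a y^{b+1} z^c w^d + b x^{a+1} y^{b-1} z^{c+1} w^d
--                    + c x^a y^b z^c w^{d+1} + d x^{a+1} y^b z^{c+1} w^{d-1},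
-- extended linearly.

Dterm : ℤ × Mon → Poly
Dterm (k , mon a b c d) =
  (k * a , mon a (b + 1ℤ) c d) ∷
  (k * b , mon (a + 1ℤ) (b - 1ℤ) (c + 1ℤ) d) ∷
  (k * c , mon a b c (d + 1ℤ)) ∷
  (k * d , mon (a + 1ℤ) b (c + 1ℤ) (d - 1ℤ)) ∷ []

D : Poly → Poly
D p = concatMap Dterm p

D^ : ℕ → Poly → Poly
D^ zero    u = u
D^ (suc n) u = D (D^ n u)

-- The ring R[Δ] = R ⊕ R·Δ with Δ² = (w+y)² − 4xz, where R is the
-- Laurent polynomial ring above.  An element (p , q) means p + qΔ.

disc : Poly
disc = ((W ⊕ Y) ⊗ (W ⊕ Y)) ⊕ (⊖ (cst (+ 4) ⊗ (X ⊗ Z)))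

RΔ : Set
RΔ = Poly × Poly

_≈Δ_ : RΔ → RΔ → Set
(p , q) ≈Δ (p' , q') = (p ≈ₚ p') × (q ≈ₚ q')

ι : Poly → RΔ
ι p = (p , [])

Δ : RΔ
Δ = ([] , cst 1ℤ)

_+Δ_ : RΔ → RΔ → RΔ
(p , q) +Δ (p' , q') = (p ⊕ p' , q ⊕ q')

-Δ_ : RΔ → RΔ
-Δ (p , q) = (⊖ p , ⊖ q)

_*Δ_ : RΔ → RΔ → RΔ
(p , q) *Δ (p' , q') = ((p ⊗ p') ⊕ ((q ⊗ q') ⊗ disc) , (p ⊗ q') ⊕ (q ⊗ p'))

_^Δ_ : RΔ → ℕ → RΔ
u ^Δ zero  = ι (cst 1ℤ)
u ^Δ suc n = u *Δ (u ^Δ n)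

natΔ : ℕ → RΔ
natΔ k = ι (cst (+ k))

0Δ : RΔ
0Δ = ι []

-- Power series in t with coefficients in R[Δ], written in exponential
-- form: a sequence a represents Σₙ aₙ tⁿ/n!.  Product of such series:
-- (a·b)ₙ = Σ_{k=0}^{n} C(n,k) a_k b_{n-k}.

EGF : Set
EGF = ℕ → RΔ

egfMul : EGF → EGF → EGF
egfMul a b n = foldr (λ k acc → (natΔ (n C k) *Δ (a k *Δ b (n ℕ.∸ k))) +Δ acc) 0Δ (upTo (suc n))

GenY : EGF
GenY n = ι (D^ n Y)

expΔ : EGF
expΔ n = Δ ^Δ n

constS : RΔ → EGF
constS c zero    = c
constS c (suc _) = 0Δ

_+S_ : EGF → EGF → EGF
(a +S b) n = a n +Δ b n

_·S_ : RΔ → EGF → EGF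
(c ·S a) n = c *Δ a n

A : RΔ
A = ι (W ⊕ Y)

xz : RΔ
xz = ι (X ⊗ Z)

Num : EGF
Num = constS (-Δ (natΔ 2 *Δ xz)) +S ((natΔ 2 *Δ xz) ·S expΔ)

Den : EGF
Den = constS (A +Δ Δ) +S ((-Δ (A +Δ (-Δ Δ))) ·S expΔ)

-- Gen p = Σ Dⁿ(p) tⁿ/n! is a ring homomorphism from Laurent polynomials to exponential series
-- that turns D into d/dt, so the grammar gives Gen(x)′ = Gen(x)Gen(y), Gen(y)′ = Gen(x)Gen(z),
-- Gen(z)′ = Gen(z)Gen(w) and Gen(w)′ = Gen(x)Gen(z).  Hence Gen(w) − Gen(y) is the constant w − y,
-- and then F = Gen(y) − y satisfies the Riccati equation F′ = F² + (w + y)F + xz with F(0) = 0.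
-- Linearising: with Den = (w + y + Δ) − (w + y − Δ)e^{tΔ} and Num = 2xz(e^{tΔ} − 1), the series
-- P = F·Den − Num satisfies 2P′ = (2F + w + y + Δ)P because Δ² = (w + y)² − 4xz, and P(0) = 0.
-- As the coefficients have no 2-torsion, P = 0 coefficient by coefficient, i.e. Gen(y)·Den = y·Den + Num.
-- Everything happens in R[Δ] = R ⊕ RΔ, so no division is needed.

module Submission where

open import Defs
open import Algebra.Bundles using (CommutativeRing)
import Algebra.Consequences.Setoid as Consequences
open import Data.Fin using (Fin; toℕ; inject₁; fromℕ)
import Data.Fin.Properties as FinP
open import Data.Integer as ℤ using (ℤ; +_; -[1+_]; _◃_; 0ℤ; 1ℤ)
import Data.Integer.Properties as ℤP
open import Data.List using (List; []; _∷_; foldr; upTo; applyUpTo)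
open import Data.Maybe using (Maybe; just; nothing)
open import Data.Nat as ℕ using (ℕ; zero; suc; _∸_; _<_; _≤_; s≤s)
import Data.Nat.Properties as ℕP
open import Data.Nat.Combinatorics using (_C_; nCk+nC[k+1]≡[n+1]C[k+1]; k>n⇒nCk≡0)
open import Data.Product using (_,_; proj₁; proj₂)
import Data.Sign as Sign
open import Function using (id; _∘_)
open import Level using (0ℓ)
open import Relation.Binary.Bundles using (Setoid)
import Relation.Binary.PropositionalEquality as ≡
open ≡ using (_≡_)
open import Relation.Nullary using (yes; no)

module ℤ-CoefficientSolver {c ℓ} (R : CommutativeRing c ℓ) where

  open CommutativeRing R
  open import Algebra.Properties.Ring ring
    using (-0#≈0#; -‿involutive; -‿distribˡ-*; -‿distribʳ-*; -‿+-comm)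
  open import Algebra.Properties.Semiring.Mult.TCOptimised semiring using (_×_; 1+×; ×-homo-+; ×1-homo-*)
  open import Algebra.Solver.Ring.AlmostCommutativeRing
    using (_-Raw-AlmostCommutative⟶_; fromCommutativeRing)
  open import Relation.Binary.Reasoning.Setoid setoid

  ⟦_⟧ℤ : ℤ → Carrier
  ⟦ + n ⟧ℤ      = n × 1#
  ⟦ -[1+ n ] ⟧ℤ = - (suc n × 1#)

  -‿homo : ∀ i → ⟦ ℤ.- i ⟧ℤ ≈ - ⟦ i ⟧ℤ
  -‿homo (+ zero)  = sym -0#≈0#
  -‿homo (+ suc n) = refl
  -‿homo -[1+ n ]  = sym (-‿involutive _)

  ⊖-homo : ∀ m n → ⟦ m ℤ.⊖ n ⟧ℤ ≈ m × 1# - n × 1#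
  ⊖-homo m zero = begin
    ⟦ m ℤ.⊖ 0 ⟧ℤ    ≡⟨ ≡.cong ⟦_⟧ℤ (ℤP.⊖-≥ {m} ℕ.z≤n) ⟩
    m × 1#          ≈⟨ +-identityʳ _ ⟨
    m × 1# + 0#     ≈⟨ +-congˡ -0#≈0# ⟨
    m × 1# - 0 × 1# ∎
  ⊖-homo zero (suc n) = sym (+-identityˡ _)
  ⊖-homo (suc m) (suc n) = begin
    ⟦ suc m ℤ.⊖ suc n ⟧ℤ          ≡⟨ ≡.cong ⟦_⟧ℤ (ℤP.[1+m]⊖[1+n]≡m⊖n m n) ⟩
    ⟦ m ℤ.⊖ n ⟧ℤ                  ≈⟨ ⊖-homo m n ⟩
    m × 1# - n × 1#               ≈⟨ cancel 1# (m × 1#) (n × 1#) ⟩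
    (1# + m × 1#) - (1# + n × 1#) ≈⟨ +-cong (1+× m 1#) (-‿cong (1+× n 1#)) ⟨
    suc m × 1# - suc n × 1#       ∎
    where
    cancel : ∀ x y z → y - z ≈ (x + y) - (x + z)
    cancel x y z = begin
      y - z                   ≈⟨ +-identityˡ _ ⟨
      0# + (y - z)            ≈⟨ +-congʳ (-‿inverseʳ x) ⟨
      (x - x) + (y - z)       ≈⟨ +-assoc x (- x) (y - z) ⟩
      x + (- x + (y - z))     ≈⟨ +-congˡ (+-assoc (- x) y (- z)) ⟨
      x + ((- x + y) - z)     ≈⟨ +-congˡ (+-congʳ (+-comm (- x) y)) ⟩
      x + ((y - x) - z)       ≈⟨ +-congˡ (+-assoc y (- x) (- z)) ⟩
      x + (y + (- x - z))     ≈⟨ +-assoc x y (- x - z) ⟨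
      (x + y) + (- x - z)     ≈⟨ +-congˡ (-‿+-comm x z) ⟩
      (x + y) - (x + z)       ∎

  +-homo : ∀ i j → ⟦ i ℤ.+ j ⟧ℤ ≈ ⟦ i ⟧ℤ + ⟦ j ⟧ℤ
  +-homo (+ m)    (+ n)    = ×-homo-+ 1# m n
  +-homo (+ m)    -[1+ n ] = ⊖-homo m (suc n)
  +-homo -[1+ m ] (+ n)    = trans (⊖-homo n (suc m)) (+-comm _ _)
  +-homo -[1+ m ] -[1+ n ] = begin
    - (suc (suc (m ℕ.+ n)) × 1#)         ≡⟨ ≡.cong (λ k → - (k × 1#)) (ℕP.+-suc (suc m) n) ⟨
    - ((suc m ℕ.+ suc n) × 1#)           ≈⟨ -‿cong (×-homo-+ 1# (suc m) (suc n)) ⟩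
    - (suc m × 1# + suc n × 1#)          ≈⟨ -‿+-comm _ _ ⟨
    - (suc m × 1#) + - (suc n × 1#)      ∎

  *-homo : ∀ i j → ⟦ i ℤ.* j ⟧ℤ ≈ ⟦ i ⟧ℤ * ⟦ j ⟧ℤ
  *-homo (+ m) (+ n) = begin
    ⟦ Sign.+ ◃ (m ℕ.* n) ⟧ℤ ≡⟨ ≡.cong ⟦_⟧ℤ (ℤP.+◃n≡+n (m ℕ.* n)) ⟩
    (m ℕ.* n) × 1#          ≈⟨ ×1-homo-* m n ⟩
    (m × 1#) * (n × 1#)     ∎
  *-homo (+ m) -[1+ n ] = begin
    ⟦ Sign.- ◃ (m ℕ.* suc n) ⟧ℤ    ≡⟨ ≡.cong ⟦_⟧ℤ (ℤP.-◃n≡-n (m ℕ.* suc n)) ⟩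
    ⟦ ℤ.- + (m ℕ.* suc n) ⟧ℤ       ≈⟨ -‿homo (+ (m ℕ.* suc n)) ⟩
    - ((m ℕ.* suc n) × 1#)         ≈⟨ -‿cong (×1-homo-* m (suc n)) ⟩
    - ((m × 1#) * (suc n × 1#))    ≈⟨ -‿distribʳ-* _ _ ⟩
    (m × 1#) * - (suc n × 1#)      ∎
  *-homo -[1+ m ] (+ n) = begin
    ⟦ Sign.- ◃ (suc m ℕ.* n) ⟧ℤ    ≡⟨ ≡.cong ⟦_⟧ℤ (ℤP.-◃n≡-n (suc m ℕ.* n)) ⟩
    ⟦ ℤ.- + (suc m ℕ.* n) ⟧ℤ       ≈⟨ -‿homo (+ (suc m ℕ.* n)) ⟩
    - ((suc m ℕ.* n) × 1#)         ≈⟨ -‿cong (×1-homo-* (suc m) n) ⟩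
    - ((suc m × 1#) * (n × 1#))    ≈⟨ -‿distribˡ-* _ _ ⟩
    - (suc m × 1#) * (n × 1#)      ∎
  *-homo -[1+ m ] -[1+ n ] = begin
    (suc m ℕ.* suc n) × 1#              ≈⟨ ×1-homo-* (suc m) (suc n) ⟩
    (suc m × 1#) * (suc n × 1#)         ≈⟨ -‿involutive _ ⟨
    - - ((suc m × 1#) * (suc n × 1#))   ≈⟨ -‿cong (-‿distribˡ-* _ _) ⟩
    - (- (suc m × 1#) * (suc n × 1#))   ≈⟨ -‿distribʳ-* _ _ ⟩
    - (suc m × 1#) * - (suc n × 1#)     ∎

  ℤ⟶R : ℤ.+-*-rawRing -Raw-AlmostCommutative⟶ fromCommutativeRing R
  ℤ⟶R = record
    { ⟦_⟧ = ⟦_⟧ℤ ; +-homo = +-homo ; *-homo = *-homo ; -‿homo = -‿homo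
    ; 0-homo = refl ; 1-homo = refl }

  ≟-coefficients : ∀ i j → Maybe (⟦ i ⟧ℤ ≈ ⟦ j ⟧ℤ)
  ≟-coefficients i j with i ℤ.≟ j
  ... | yes ≡.refl = just refl
  ... | no _       = nothing

  open import Algebra.Solver.Ring ℤ.+-*-rawRing (fromCommutativeRing R) ℤ⟶R ≟-coefficients public

module LaurentPolynomials where

  open import Data.Integer using (_+_; _*_; -_; _-_)
  open ≡
  open import Data.Bool using (true; false; if_then_else_)
  open import Data.Integer.Tactic.RingSolver using (solve-∀)
  open import Data.List using (map; filter)
  open import Data.List.Properties using (concatMap-++)
  open import Data.Product using (_×_)
  open import Function.Bundles using (_⇔_; mk⇔)
  open import Function.Nary.NonDependent using (congₙ)
  open import Relation.Binary.Definitions using (DecidableEquality)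
  open import Relation.Nullary using (Dec; does; ¬?)
  open import Relation.Nullary.Decidable using (map′; _×-dec_; does-⇔)

  mon-≡ : ∀ {a b c d a′ b′ c′ d′} → a ≡ a′ → b ≡ b′ → c ≡ c′ → d ≡ d′ → mon a b c d ≡ mon a′ b′ c′ d′
  mon-≡ refl refl refl refl = refl

  infix 4 _≟ₘ_
  _≟ₘ_ : DecidableEquality Mon
  mon a b c d ≟ₘ mon a′ b′ c′ d′ =
    map′ (λ { (p , q , r , s) → mon-≡ p q r s })
         (λ { refl → refl , refl , refl , refl })
         (a ℤ.≟ a′ ×-dec b ℤ.≟ b′ ×-dec c ℤ.≟ c′ ×-dec d ℤ.≟ d′)

  1ₘ : Mon
  1ₘ = mon 0ℤ 0ℤ 0ℤ 0ℤ

  infix 30 _⁻¹ₘ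
  _⁻¹ₘ : Mon → Mon
  mon a b c d ⁻¹ₘ = mon (- a) (- b) (- c) (- d)

  ·ₘ-comm : ∀ m₁ m₂ → m₁ ·ₘ m₂ ≡ m₂ ·ₘ m₁
  ·ₘ-comm (mon a b c d) (mon a′ b′ c′ d′) =
    mon-≡ (ℤP.+-comm a a′) (ℤP.+-comm b b′) (ℤP.+-comm c c′) (ℤP.+-comm d d′)

  ·ₘ-assoc : ∀ m₁ m₂ m₃ → (m₁ ·ₘ m₂) ·ₘ m₃ ≡ m₁ ·ₘ (m₂ ·ₘ m₃)
  ·ₘ-assoc (mon a b c d) (mon a′ b′ c′ d′) (mon a″ b″ c″ d″) =
    mon-≡ (ℤP.+-assoc a a′ a″) (ℤP.+-assoc b b′ b″) (ℤP.+-assoc c c′ c″) (ℤP.+-assoc d d′ d″)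

  ·ₘ-identityˡ : ∀ m → 1ₘ ·ₘ m ≡ m
  ·ₘ-identityˡ (mon a b c d) = mon-≡ (ℤP.+-identityˡ a) (ℤP.+-identityˡ b) (ℤP.+-identityˡ c) (ℤP.+-identityˡ d)

  ·ₘ-cancelʳ : ∀ m v → (m ·ₘ v) ·ₘ v ⁻¹ₘ ≡ m
  ·ₘ-cancelʳ (mon a b c d) (mon a′ b′ c′ d′) = mon-≡ (lemma a a′) (lemma b b′) (lemma c c′) (lemma d d′)
    where lemma : ∀ x y → x + y + - y ≡ x
          lemma = solve-∀

  ·ₘ-uncancelʳ : ∀ m v → (m ·ₘ v ⁻¹ₘ) ·ₘ v ≡ m
  ·ₘ-uncancelʳ (mon a b c d) (mon a′ b′ c′ d′) = mon-≡ (lemma a a′) (lemma b b′) (lemma c c′) (lemma d d′)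
    where lemma : ∀ x y → x + - y + y ≡ x
          lemma = solve-∀

  ·ₘ-divideʳ : ∀ {m₁ v m} → m₁ ·ₘ v ≡ m ⇔ m₁ ≡ m ·ₘ v ⁻¹ₘ
  ·ₘ-divideʳ {m₁} {v} {m} = mk⇔
    (λ eq → trans (sym (·ₘ-cancelʳ m₁ v)) (cong (_·ₘ v ⁻¹ₘ) eq))
    (λ eq → trans (cong (_·ₘ v) eq) (·ₘ-uncancelʳ m v))

  -- Coefficients are pairings with indicator functions, coeff p m = ⟨ p ∣ δ m ⟩, so the ring laws
  -- of Poly reduce to rearranging the finite sums ⟨ p ∣ f ⟩ = Σ c · f m over the terms (c , m) of p.
  δ : Mon → Mon → ℤ
  δ m m′ = if does (m′ ≟ₘ m) then 1ℤ else 0ℤ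

  δ-·ʳ : ∀ m m₁ v → δ m (m₁ ·ₘ v) ≡ δ (m ·ₘ v ⁻¹ₘ) m₁
  δ-·ʳ m m₁ v = cong (λ b → if b then 1ℤ else 0ℤ) (does-⇔ ·ₘ-divideʳ (m₁ ·ₘ v ≟ₘ m) (m₁ ≟ₘ m ·ₘ v ⁻¹ₘ))

  ⟨_∣_⟩ : Poly → (Mon → ℤ) → ℤ
  ⟨ [] ∣ f ⟩          = 0ℤ
  ⟨ (c , m) ∷ p ∣ f ⟩ = c * f m + ⟨ p ∣ f ⟩

  coeff≡⟨δ⟩ : ∀ p m → coeff p m ≡ ⟨ p ∣ δ m ⟩
  coeff≡⟨δ⟩ []             m = refl
  coeff≡⟨δ⟩ ((c , m′) ∷ p) m = cong₂ _+_ (if-as-* (does (m′ ≟ₘ m))) (coeff≡⟨δ⟩ p m)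
    where if-as-* : ∀ b → (if b then c else 0ℤ) ≡ c * (if b then 1ℤ else 0ℤ)
          if-as-* true  = sym (ℤP.*-identityʳ c)
          if-as-* false = sym (ℤP.*-zeroʳ c)

  ⟨⟩-cong : ∀ p {f g} → (∀ m → f m ≡ g m) → ⟨ p ∣ f ⟩ ≡ ⟨ p ∣ g ⟩
  ⟨⟩-cong []            f≗g = refl
  ⟨⟩-cong ((c , m) ∷ p) f≗g = cong₂ _+_ (cong (c *_) (f≗g m)) (⟨⟩-cong p f≗g)

  ⟨⊕⟩ : ∀ p q f → ⟨ p ⊕ q ∣ f ⟩ ≡ ⟨ p ∣ f ⟩ + ⟨ q ∣ f ⟩
  ⟨⊕⟩ []            q f = sym (ℤP.+-identityˡ _)
  ⟨⊕⟩ ((c , m) ∷ p) q f = trans (cong (_+_ (c * f m)) (⟨⊕⟩ p q f)) (sym (ℤP.+-assoc (c * f m) _ _))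

  ⟨⊖⟩ : ∀ p f → ⟨ ⊖ p ∣ f ⟩ ≡ - ⟨ p ∣ f ⟩
  ⟨⊖⟩ []            f = refl
  ⟨⊖⟩ ((c , m) ∷ p) f =
    trans (cong₂ _+_ (sym (ℤP.neg-distribˡ-* c (f m))) (⟨⊖⟩ p f)) (sym (ℤP.neg-distrib-+ (c * f m) _))

  ⟨⟩-+ : ∀ p f g → ⟨ p ∣ (λ m → f m + g m) ⟩ ≡ ⟨ p ∣ f ⟩ + ⟨ p ∣ g ⟩
  ⟨⟩-+ []            f g = refl
  ⟨⟩-+ ((c , m) ∷ p) f g = trans (cong (_+_ (c * (f m + g m))) (⟨⟩-+ p f g)) (lemma c (f m) (g m) _ _)
    where lemma : ∀ c x y u v → c * (x + y) + (u + v) ≡ (c * x + u) + (c * y + v)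
          lemma = solve-∀

  ⟨⟩-* : ∀ p k f → ⟨ p ∣ (λ m → k * f m) ⟩ ≡ k * ⟨ p ∣ f ⟩
  ⟨⟩-* []            k f = sym (ℤP.*-zeroʳ k)
  ⟨⟩-* ((c , m) ∷ p) k f = trans (cong (_+_ (c * (k * f m))) (⟨⟩-* p k f)) (lemma c k (f m) _)
    where lemma : ∀ c k x u → c * (k * x) + k * u ≡ k * (c * x + u)
          lemma = solve-∀

  ⟨⟩-0 : ∀ p → ⟨ p ∣ (λ _ → 0ℤ) ⟩ ≡ 0ℤ
  ⟨⟩-0 []            = refl
  ⟨⟩-0 ((c , m) ∷ p) = cong₂ _+_ (ℤP.*-zeroʳ c) (⟨⟩-0 p)

  ⟨⊗⟩ : ∀ p q f → ⟨ p ⊗ q ∣ f ⟩ ≡ ⟨ p ∣ (λ m₁ → ⟨ q ∣ (λ m₂ → f (m₁ ·ₘ m₂)) ⟩) ⟩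
  ⟨⊗⟩ []            q f = refl
  ⟨⊗⟩ ((c , m) ∷ p) q f = trans (⟨⊕⟩ (map (scale c m) q) (p ⊗ q) f) (cong₂ _+_ (⟨scale⟩ q) (⟨⊗⟩ p q f))
    where
    scale : ℤ → Mon → ℤ × Mon → ℤ × Mon
    scale c m (c′ , m′) = (c * c′ , m ·ₘ m′)
    ⟨scale⟩ : ∀ q → ⟨ map (scale c m) q ∣ f ⟩ ≡ c * ⟨ q ∣ (λ m₂ → f (m ·ₘ m₂)) ⟩
    ⟨scale⟩ []              = sym (ℤP.*-zeroʳ c)
    ⟨scale⟩ ((c′ , m′) ∷ q) = trans (cong (_+_ (c * c′ * f (m ·ₘ m′))) (⟨scale⟩ q)) (lemma c c′ _ _)
      where lemma : ∀ c c′ x u → c * c′ * x + c * u ≡ c * (c′ * x + u)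
            lemma = solve-∀

  ⟨⟩-swap : ∀ p q (h : Mon → Mon → ℤ) →
            ⟨ p ∣ (λ m₁ → ⟨ q ∣ h m₁ ⟩) ⟩ ≡ ⟨ q ∣ (λ m₂ → ⟨ p ∣ (λ m₁ → h m₁ m₂) ⟩) ⟩
  ⟨⟩-swap []            q h = sym (⟨⟩-0 q)
  ⟨⟩-swap ((c , m) ∷ p) q h = trans (cong₂ _+_ (sym (⟨⟩-* q c (h m))) (⟨⟩-swap p q h))
                                    (sym (⟨⟩-+ q (λ m₂ → c * h m m₂) _))

  ⟨⟩-weighted-δ : ∀ p (e : Mon → ℤ) m → ⟨ p ∣ (λ m₁ → e m₁ * δ m m₁) ⟩ ≡ e m * coeff p m
  ⟨⟩-weighted-δ p e m = begin
    ⟨ p ∣ (λ m₁ → e m₁ * δ m m₁) ⟩ ≡⟨ ⟨⟩-cong p weight-at-m ⟩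
    ⟨ p ∣ (λ m₁ → e m * δ m m₁) ⟩  ≡⟨ ⟨⟩-* p (e m) (δ m) ⟩
    e m * ⟨ p ∣ δ m ⟩              ≡⟨ cong (e m *_) (coeff≡⟨δ⟩ p m) ⟨
    e m * coeff p m                ∎
    where
    open ≡-Reasoning
    weight-at-m : ∀ m₁ → e m₁ * δ m m₁ ≡ e m * δ m m₁
    weight-at-m m₁ = by-cases (m₁ ≟ₘ m)
      where
      by-cases : (d : Dec (m₁ ≡ m)) → e m₁ * (if does d then 1ℤ else 0ℤ) ≡ e m * (if does d then 1ℤ else 0ℤ)
      by-cases (yes refl) = refl
      by-cases (no _)     = trans (ℤP.*-zeroʳ (e m₁)) (sym (ℤP.*-zeroʳ (e m)))

  coeff-⊗ : ∀ p q m → coeff (p ⊗ q) m ≡ ⟨ p ∣ (λ m₁ → ⟨ q ∣ (λ m₂ → δ m (m₁ ·ₘ m₂)) ⟩) ⟩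
  coeff-⊗ p q m = trans (coeff≡⟨δ⟩ (p ⊗ q) m) (⟨⊗⟩ p q (δ m))

  ⟨δ·⟩ : ∀ q m m₁ → ⟨ q ∣ (λ m₂ → δ m (m₁ ·ₘ m₂)) ⟩ ≡ coeff q (m ·ₘ m₁ ⁻¹ₘ)
  ⟨δ·⟩ q m m₁ = begin
    ⟨ q ∣ (λ m₂ → δ m (m₁ ·ₘ m₂)) ⟩       ≡⟨ ⟨⟩-cong q (λ m₂ → trans (cong (δ m) (·ₘ-comm m₁ m₂)) (δ-·ʳ m m₂ m₁)) ⟩
    ⟨ q ∣ δ (m ·ₘ m₁ ⁻¹ₘ) ⟩                ≡⟨ coeff≡⟨δ⟩ q _ ⟨
    coeff q (m ·ₘ m₁ ⁻¹ₘ)                 ∎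
    where open ≡-Reasoning

  coeff-⊕ : ∀ p q m → coeff (p ⊕ q) m ≡ coeff p m + coeff q m
  coeff-⊕ p q m = trans (coeff≡⟨δ⟩ (p ⊕ q) m) (trans (⟨⊕⟩ p q (δ m)) (sym (cong₂ _+_ (coeff≡⟨δ⟩ p m) (coeff≡⟨δ⟩ q m))))

  coeff-⊖ : ∀ p m → coeff (⊖ p) m ≡ - coeff p m
  coeff-⊖ p m = trans (coeff≡⟨δ⟩ (⊖ p) m) (trans (⟨⊖⟩ p (δ m)) (sym (cong -_ (coeff≡⟨δ⟩ p m))))

  ⟨⟩-shifted-δ : ∀ p (e : Mon → ℤ) v m →
                 ⟨ p ∣ (λ m₁ → e m₁ * δ m (m₁ ·ₘ v)) ⟩ ≡ e (m ·ₘ v ⁻¹ₘ) * coeff p (m ·ₘ v ⁻¹ₘ)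
  ⟨⟩-shifted-δ p e v m =
    trans (⟨⟩-cong p (λ m₁ → cong (e m₁ *_) (δ-·ʳ m m₁ v))) (⟨⟩-weighted-δ p e (m ·ₘ v ⁻¹ₘ))

  -- A record rather than the function type _≈ₚ_, so that p and q can be inferred from a proof.
  record _≃_ (p q : Poly) : Set where
    constructor coeffwise
    field coeffs : p ≈ₚ q
  open _≃_ public

  ≃-setoid : Setoid 0ℓ 0ℓ
  ≃-setoid = record
    { Carrier = Poly ; _≈_ = _≃_
    ; isEquivalence = record
      { refl  = coeffwise (λ _ → refl)
      ; sym   = λ p≃q → coeffwise (λ m → sym (coeffs p≃q m))
      ; trans = λ p≃q q≃r → coeffwise (λ m → trans (coeffs p≃q m) (coeffs q≃r m)) } }

  module ≃ = Setoid ≃-setoid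

  ⊕-cong : ∀ {p p′ q q′} → p ≃ p′ → q ≃ q′ → (p ⊕ q) ≃ (p′ ⊕ q′)
  ⊕-cong {p} {p′} {q} {q′} p≃p′ q≃q′ = coeffwise λ m →
    trans (coeff-⊕ p q m) (trans (cong₂ _+_ (coeffs p≃p′ m) (coeffs q≃q′ m)) (sym (coeff-⊕ p′ q′ m)))

  ⊕-assoc : ∀ p q r → ((p ⊕ q) ⊕ r) ≃ (p ⊕ (q ⊕ r))
  ⊕-assoc p q r = coeffwise λ m → begin
    coeff ((p ⊕ q) ⊕ r) m              ≡⟨ trans (coeff-⊕ (p ⊕ q) r m) (cong (_+ coeff r m) (coeff-⊕ p q m)) ⟩
    coeff p m + coeff q m + coeff r m  ≡⟨ ℤP.+-assoc (coeff p m) _ _ ⟩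
    coeff p m + (coeff q m + coeff r m) ≡⟨ trans (coeff-⊕ p (q ⊕ r) m) (cong (_+_ (coeff p m)) (coeff-⊕ q r m)) ⟨
    coeff (p ⊕ (q ⊕ r)) m              ∎
    where open ≡-Reasoning

  ⊕-comm : ∀ p q → (p ⊕ q) ≃ (q ⊕ p)
  ⊕-comm p q = coeffwise λ m →
    trans (coeff-⊕ p q m) (trans (ℤP.+-comm (coeff p m) _) (sym (coeff-⊕ q p m)))

  ⊕-identityˡ : ∀ p → ([] ⊕ p) ≃ p
  ⊕-identityˡ p = coeffwise λ m → refl

  ⊖-cong : ∀ {p q} → p ≃ q → (⊖ p) ≃ (⊖ q)
  ⊖-cong {p} {q} p≃q = coeffwise λ m → trans (coeff-⊖ p m) (trans (cong -_ (coeffs p≃q m)) (sym (coeff-⊖ q m)))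

  ⊖-inverseˡ : ∀ p → ((⊖ p) ⊕ p) ≃ []
  ⊖-inverseˡ p = coeffwise λ m →
    trans (coeff-⊕ (⊖ p) p m) (trans (cong (_+ coeff p m) (coeff-⊖ p m)) (ℤP.+-inverseˡ (coeff p m)))

  ⊗-comm : ∀ p q → (p ⊗ q) ≃ (q ⊗ p)
  ⊗-comm p q = coeffwise λ m → begin
    coeff (p ⊗ q) m                                        ≡⟨ coeff-⊗ p q m ⟩
    ⟨ p ∣ (λ m₁ → ⟨ q ∣ (λ m₂ → δ m (m₁ ·ₘ m₂)) ⟩) ⟩      ≡⟨ ⟨⟩-swap p q (λ m₁ m₂ → δ m (m₁ ·ₘ m₂)) ⟩
    ⟨ q ∣ (λ m₂ → ⟨ p ∣ (λ m₁ → δ m (m₁ ·ₘ m₂)) ⟩) ⟩      ≡⟨ ⟨⟩-cong q (λ m₂ → ⟨⟩-cong p (λ m₁ → cong (δ m) (·ₘ-comm m₁ m₂))) ⟩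
    ⟨ q ∣ (λ m₂ → ⟨ p ∣ (λ m₁ → δ m (m₂ ·ₘ m₁)) ⟩) ⟩      ≡⟨ coeff-⊗ q p m ⟨
    coeff (q ⊗ p) m                                        ∎
    where open ≡-Reasoning

  ⊗-congʳ : ∀ p {q q′} → q ≃ q′ → (p ⊗ q) ≃ (p ⊗ q′)
  ⊗-congʳ p {q} {q′} q≃q′ = coeffwise λ m → begin
    coeff (p ⊗ q) m                                  ≡⟨ coeff-⊗ p q m ⟩
    ⟨ p ∣ (λ m₁ → ⟨ q ∣ (λ m₂ → δ m (m₁ ·ₘ m₂)) ⟩) ⟩  ≡⟨ ⟨⟩-cong p (λ m₁ → ⟨δ·⟩ q m m₁) ⟩
    ⟨ p ∣ (λ m₁ → coeff q (m ·ₘ m₁ ⁻¹ₘ)) ⟩           ≡⟨ ⟨⟩-cong p (λ m₁ → coeffs q≃q′ (m ·ₘ m₁ ⁻¹ₘ)) ⟩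
    ⟨ p ∣ (λ m₁ → coeff q′ (m ·ₘ m₁ ⁻¹ₘ)) ⟩          ≡⟨ ⟨⟩-cong p (λ m₁ → ⟨δ·⟩ q′ m m₁) ⟨
    ⟨ p ∣ (λ m₁ → ⟨ q′ ∣ (λ m₂ → δ m (m₁ ·ₘ m₂)) ⟩) ⟩ ≡⟨ coeff-⊗ p q′ m ⟨
    coeff (p ⊗ q′) m                                 ∎
    where open ≡-Reasoning

  ⊗-cong : ∀ {p p′ q q′} → p ≃ p′ → q ≃ q′ → (p ⊗ q) ≃ (p′ ⊗ q′)
  ⊗-cong {p} {p′} {q} {q′} p≃p′ q≃q′ = begin
    p ⊗ q   ≈⟨ ⊗-congʳ p q≃q′ ⟩
    p ⊗ q′  ≈⟨ ⊗-comm p q′ ⟩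
    q′ ⊗ p  ≈⟨ ⊗-congʳ q′ p≃p′ ⟩
    q′ ⊗ p′ ≈⟨ ⊗-comm q′ p′ ⟩
    p′ ⊗ q′ ∎
    where open import Relation.Binary.Reasoning.Setoid ≃-setoid

  ⊗-assoc : ∀ p q r → ((p ⊗ q) ⊗ r) ≃ (p ⊗ (q ⊗ r))
  ⊗-assoc p q r = coeffwise λ m → begin
    coeff ((p ⊗ q) ⊗ r) m
      ≡⟨ trans (coeff≡⟨δ⟩ ((p ⊗ q) ⊗ r) m) (trans (⟨⊗⟩ (p ⊗ q) r (δ m)) (⟨⊗⟩ p q _)) ⟩
    ⟨ p ∣ (λ m₁ → ⟨ q ∣ (λ m₂ → ⟨ r ∣ (λ m₃ → δ m ((m₁ ·ₘ m₂) ·ₘ m₃)) ⟩) ⟩) ⟩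
      ≡⟨ ⟨⟩-cong p (λ m₁ → ⟨⟩-cong q (λ m₂ → ⟨⟩-cong r (λ m₃ → cong (δ m) (·ₘ-assoc m₁ m₂ m₃)))) ⟩
    ⟨ p ∣ (λ m₁ → ⟨ q ∣ (λ m₂ → ⟨ r ∣ (λ m₃ → δ m (m₁ ·ₘ (m₂ ·ₘ m₃))) ⟩) ⟩) ⟩
      ≡⟨ ⟨⟩-cong p (λ m₁ → ⟨⊗⟩ q r (λ m₂₃ → δ m (m₁ ·ₘ m₂₃))) ⟨
    ⟨ p ∣ (λ m₁ → ⟨ q ⊗ r ∣ (λ m₂₃ → δ m (m₁ ·ₘ m₂₃)) ⟩) ⟩
      ≡⟨ coeff-⊗ p (q ⊗ r) m ⟨
    coeff (p ⊗ (q ⊗ r)) m ∎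
    where open ≡-Reasoning

  ⊗-identityˡ : ∀ p → (cst 1ℤ ⊗ p) ≃ p
  ⊗-identityˡ p = coeffwise λ m → begin
    coeff (cst 1ℤ ⊗ p) m                   ≡⟨ coeff-⊗ (cst 1ℤ) p m ⟩
    1ℤ * ⟨ p ∣ (λ m₂ → δ m (1ₘ ·ₘ m₂)) ⟩ + 0ℤ ≡⟨ trans (ℤP.+-identityʳ _) (ℤP.*-identityˡ _) ⟩
    ⟨ p ∣ (λ m₂ → δ m (1ₘ ·ₘ m₂)) ⟩        ≡⟨ ⟨⟩-cong p (λ m₂ → cong (δ m) (·ₘ-identityˡ m₂)) ⟩
    ⟨ p ∣ δ m ⟩                            ≡⟨ coeff≡⟨δ⟩ p m ⟨
    coeff p m                              ∎
    where open ≡-Reasoning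

  ⊗-distribʳ : ∀ p q r → ((q ⊕ r) ⊗ p) ≃ ((q ⊗ p) ⊕ (r ⊗ p))
  ⊗-distribʳ p q r = coeffwise λ m → begin
    coeff ((q ⊕ r) ⊗ p) m                               ≡⟨ trans (coeff≡⟨δ⟩ ((q ⊕ r) ⊗ p) m) (⟨⊗⟩ (q ⊕ r) p (δ m)) ⟩
    ⟨ q ⊕ r ∣ (λ m₁ → ⟨ p ∣ (λ m₂ → δ m (m₁ ·ₘ m₂)) ⟩) ⟩ ≡⟨ ⟨⊕⟩ q r _ ⟩
    ⟨ q ∣ _ ⟩ + ⟨ r ∣ _ ⟩                               ≡⟨ cong₂ _+_ (coeff-⊗ q p m) (coeff-⊗ r p m) ⟨
    coeff (q ⊗ p) m + coeff (r ⊗ p) m                   ≡⟨ coeff-⊕ (q ⊗ p) (r ⊗ p) m ⟨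
    coeff ((q ⊗ p) ⊕ (r ⊗ p)) m                         ∎
    where open ≡-Reasoning

  polyRing : CommutativeRing 0ℓ 0ℓ
  polyRing = record
    { Carrier = Poly ; _≈_ = _≃_ ; _+_ = _⊕_ ; _*_ = _⊗_ ; -_ = ⊖_ ; 0# = [] ; 1# = cst 1ℤ
    ; isCommutativeRing = record
      { isRing = record
        { +-isAbelianGroup = record
          { isGroup = record
            { isMonoid = record
              { isSemigroup = record
                { isMagma = record { isEquivalence = ≃.isEquivalence ; ∙-cong = ⊕-cong }
                ; assoc = ⊕-assoc }
              ; identity = comm∧idˡ⇒id ⊕-comm ⊕-identityˡ }
            ; inverse = comm∧invˡ⇒inv ⊕-comm ⊖-inverseˡ
            ; ⁻¹-cong = ⊖-cong }
          ; comm = ⊕-comm }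
        ; *-cong = ⊗-cong
        ; *-assoc = ⊗-assoc
        ; *-identity = comm∧idˡ⇒id ⊗-comm ⊗-identityˡ
        ; distrib = comm∧distrʳ⇒distr ⊕-cong ⊗-comm ⊗-distribʳ }
      ; *-comm = ⊗-comm } }
    where open Consequences ≃-setoid

  -- On monomials D(m) = m · (ex m ρx + ey m ρy + ez m ρz + ew m ρw), where ρv = D(v)/v.
  ρx ρy ρz ρw : Mon
  ρx = mon 0ℤ 1ℤ 0ℤ 0ℤ
  ρy = mon 1ℤ (- 1ℤ) 1ℤ 0ℤ
  ρz = mon 0ℤ 0ℤ 0ℤ 1ℤ
  ρw = mon 1ℤ 0ℤ 1ℤ (- 1ℤ)

  ∂⟨_∣_⟩ : Mon → (Mon → ℤ) → ℤ
  ∂⟨ m ∣ f ⟩ = ex m * f (m ·ₘ ρx) + (ey m * f (m ·ₘ ρy) + (ez m * f (m ·ₘ ρz) + ew m * f (m ·ₘ ρw)))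

  ⟨Dterm⟩ : ∀ k m f → ⟨ Dterm (k , m) ∣ f ⟩ ≡ k * ∂⟨ m ∣ f ⟩
  ⟨Dterm⟩ k (mon a b c d) f = begin
    ⟨ Dterm (k , mon a b c d) ∣ f ⟩
      ≡⟨ congₙ 4 (λ u v w t → k * a * f u + (k * b * f v + (k * c * f w + (k * d * f t + 0ℤ))))
               (mon-≡ (ℤP.+-identityʳ a) refl (ℤP.+-identityʳ c) (ℤP.+-identityʳ d))
               (mon-≡ refl refl refl (ℤP.+-identityʳ d))
               (mon-≡ (ℤP.+-identityʳ a) (ℤP.+-identityʳ b) (ℤP.+-identityʳ c) refl)
               (mon-≡ refl (ℤP.+-identityʳ b) refl refl) ⟨
    k * a * f (m ·ₘ ρx) + (k * b * f (m ·ₘ ρy) + (k * c * f (m ·ₘ ρz) + (k * d * f (m ·ₘ ρw) + 0ℤ)))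
      ≡⟨ lemma k a b c d (f (m ·ₘ ρx)) (f (m ·ₘ ρy)) (f (m ·ₘ ρz)) (f (m ·ₘ ρw)) ⟩
    k * ∂⟨ m ∣ f ⟩ ∎
    where
    open ≡-Reasoning
    m = mon a b c d
    lemma : ∀ k a b c d x y z w → k * a * x + (k * b * y + (k * c * z + (k * d * w + 0ℤ)))
                                ≡ k * (a * x + (b * y + (c * z + d * w)))
    lemma = solve-∀

  ⟨D⟩ : ∀ p f → ⟨ D p ∣ f ⟩ ≡ ⟨ p ∣ (λ m → ∂⟨ m ∣ f ⟩) ⟩
  ⟨D⟩ []            f = refl
  ⟨D⟩ ((k , m) ∷ p) f = trans (⟨⊕⟩ (Dterm (k , m)) (D p) f) (cong₂ _+_ (⟨Dterm⟩ k m f) (⟨D⟩ p f))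

  ∂-⟨⟩ : ∀ m q (h : Mon → Mon → ℤ) → ∂⟨ m ∣ (λ u → ⟨ q ∣ h u ⟩) ⟩ ≡ ⟨ q ∣ (λ m₂ → ∂⟨ m ∣ (λ u → h u m₂) ⟩) ⟩
  ∂-⟨⟩ m q h = sym (begin
    ⟨ q ∣ (λ m₂ → ex m * h Mx m₂ + (ey m * h My m₂ + (ez m * h Mz m₂ + ew m * h Mw m₂))) ⟩
      ≡⟨ ⟨⟩-+ q _ _ ⟩
    ⟨ q ∣ (λ m₂ → ex m * h Mx m₂) ⟩ + ⟨ q ∣ (λ m₂ → ey m * h My m₂ + (ez m * h Mz m₂ + ew m * h Mw m₂)) ⟩
      ≡⟨ cong₂ _+_ (⟨⟩-* q (ex m) (h Mx)) (trans (⟨⟩-+ q _ _) (cong₂ _+_ (⟨⟩-* q (ey m) (h My))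
           (trans (⟨⟩-+ q _ _) (cong₂ _+_ (⟨⟩-* q (ez m) (h Mz)) (⟨⟩-* q (ew m) (h Mw)))))) ⟩
    ∂⟨ m ∣ (λ u → ⟨ q ∣ h u ⟩) ⟩ ∎)
    where
    open ≡-Reasoning
    Mx = m ·ₘ ρx
    My = m ·ₘ ρy
    Mz = m ·ₘ ρz
    Mw = m ·ₘ ρw

  ∂-leibniz : ∀ m₁ m₂ f → ∂⟨ m₁ ·ₘ m₂ ∣ f ⟩ ≡ ∂⟨ m₁ ∣ (λ u → f (u ·ₘ m₂)) ⟩ + ∂⟨ m₂ ∣ (λ v → f (m₁ ·ₘ v)) ⟩
  ∂-leibniz m₁ m₂ f =
    trans (split (ex m₁) (ey m₁) (ez m₁) (ew m₁) (ex m₂) (ey m₂) (ez m₂) (ew m₂) (F ρx) (F ρy) (F ρz) (F ρw))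
          (cong₂ _+_ (∂-cong-at m₁ F (λ u → f (u ·ₘ m₂)) left) (∂-cong-at m₂ F (λ v → f (m₁ ·ₘ v)) right))
    where
    split : ∀ a b c d a′ b′ c′ d′ x y z w →
      (a + a′) * x + ((b + b′) * y + ((c + c′) * z + (d + d′) * w))
      ≡ (a * x + (b * y + (c * z + d * w))) + (a′ * x + (b′ * y + (c′ * z + d′ * w)))
    split = solve-∀
    F : Mon → ℤ
    F ρ = f ((m₁ ·ₘ m₂) ·ₘ ρ)
    ∂-cong-at : ∀ m (F g : Mon → ℤ) → (∀ ρ → F ρ ≡ g (m ·ₘ ρ)) →
                ex m * F ρx + (ey m * F ρy + (ez m * F ρz + ew m * F ρw)) ≡ ∂⟨ m ∣ g ⟩
    ∂-cong-at m F g eq = congₙ 4 (λ x y z w → ex m * x + (ey m * y + (ez m * z + ew m * w))) (eq ρx) (eq ρy) (eq ρz) (eq ρw)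
    left : ∀ ρ → F ρ ≡ f ((m₁ ·ₘ ρ) ·ₘ m₂)
    left ρ = cong f (trans (·ₘ-assoc m₁ m₂ ρ) (trans (cong (m₁ ·ₘ_) (·ₘ-comm m₂ ρ)) (sym (·ₘ-assoc m₁ ρ m₂))))
    right : ∀ ρ → F ρ ≡ f (m₁ ·ₘ (m₂ ·ₘ ρ))
    right ρ = cong f (·ₘ-assoc m₁ m₂ ρ)

  D-leibniz : ∀ p q → D (p ⊗ q) ≃ ((D p ⊗ q) ⊕ (p ⊗ D q))
  D-leibniz p q = coeffwise λ m → begin
    coeff (D (p ⊗ q)) m
      ≡⟨ trans (coeff≡⟨δ⟩ (D (p ⊗ q)) m) (trans (⟨D⟩ (p ⊗ q) (δ m)) (⟨⊗⟩ p q _)) ⟩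
    ⟨ p ∣ (λ m₁ → ⟨ q ∣ (λ m₂ → ∂⟨ m₁ ·ₘ m₂ ∣ δ m ⟩) ⟩) ⟩
      ≡⟨ ⟨⟩-cong p (λ m₁ → trans (⟨⟩-cong q (λ m₂ → ∂-leibniz m₁ m₂ (δ m))) (⟨⟩-+ q _ _)) ⟩
    ⟨ p ∣ (λ m₁ → ⟨ q ∣ (λ m₂ → ∂⟨ m₁ ∣ (λ u → δ m (u ·ₘ m₂)) ⟩) ⟩ + ⟨ q ∣ (λ m₂ → ∂⟨ m₂ ∣ (λ v → δ m (m₁ ·ₘ v)) ⟩) ⟩) ⟩
      ≡⟨ ⟨⟩-+ p _ _ ⟩
    ⟨ p ∣ (λ m₁ → ⟨ q ∣ (λ m₂ → ∂⟨ m₁ ∣ (λ u → δ m (u ·ₘ m₂)) ⟩) ⟩) ⟩ + ⟨ p ∣ (λ m₁ → ⟨ q ∣ (λ m₂ → ∂⟨ m₂ ∣ (λ v → δ m (m₁ ·ₘ v)) ⟩) ⟩) ⟩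
      ≡⟨ cong₂ _+_ (⟨⟩-cong p (λ m₁ → ∂-⟨⟩ m₁ q (λ u m₂ → δ m (u ·ₘ m₂))))
                   (⟨⟩-cong p (λ m₁ → ⟨D⟩ q (λ v → δ m (m₁ ·ₘ v)))) ⟨
    ⟨ p ∣ (λ m₁ → ∂⟨ m₁ ∣ (λ u → ⟨ q ∣ (λ m₂ → δ m (u ·ₘ m₂)) ⟩) ⟩) ⟩ + ⟨ p ∣ (λ m₁ → ⟨ D q ∣ (λ v → δ m (m₁ ·ₘ v)) ⟩) ⟩
      ≡⟨ cong₂ _+_ (trans (⟨⊗⟩ (D p) q (δ m)) (⟨D⟩ p _)) (⟨⊗⟩ p (D q) (δ m)) ⟨
    ⟨ D p ⊗ q ∣ δ m ⟩ + ⟨ p ⊗ D q ∣ δ m ⟩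
      ≡⟨ trans (coeff≡⟨δ⟩ ((D p ⊗ q) ⊕ (p ⊗ D q)) m) (⟨⊕⟩ (D p ⊗ q) (p ⊗ D q) (δ m)) ⟨
    coeff ((D p ⊗ q) ⊕ (p ⊗ D q)) m ∎
    where open ≡-Reasoning

  D-⊕ : ∀ p q → D (p ⊕ q) ≃ (D p ⊕ D q)
  D-⊕ p q = coeffwise λ m → cong (λ r → coeff r m) (concatMap-++ Dterm p q)

  ∂ᵀ⟨_∣_⟩ : Mon → (Mon → ℤ) → ℤ
  ∂ᵀ⟨ m ∣ c ⟩ = ex (m ·ₘ ρx ⁻¹ₘ) * c (m ·ₘ ρx ⁻¹ₘ) + (ey (m ·ₘ ρy ⁻¹ₘ) * c (m ·ₘ ρy ⁻¹ₘ)
              + (ez (m ·ₘ ρz ⁻¹ₘ) * c (m ·ₘ ρz ⁻¹ₘ) + ew (m ·ₘ ρw ⁻¹ₘ) * c (m ·ₘ ρw ⁻¹ₘ)))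

  coeff-D : ∀ p m → coeff (D p) m ≡ ∂ᵀ⟨ m ∣ coeff p ⟩
  coeff-D p m = begin
    coeff (D p) m                   ≡⟨ trans (coeff≡⟨δ⟩ (D p) m) (⟨D⟩ p (δ m)) ⟩
    ⟨ p ∣ (λ m₁ → ∂⟨ m₁ ∣ δ m ⟩) ⟩  ≡⟨ trans (⟨⟩-+ p _ _) (cong₂ _+_ (⟨⟩-shifted-δ p ex ρx m)
                                         (trans (⟨⟩-+ p _ _) (cong₂ _+_ (⟨⟩-shifted-δ p ey ρy m)
                                         (trans (⟨⟩-+ p _ _) (cong₂ _+_ (⟨⟩-shifted-δ p ez ρz m) (⟨⟩-shifted-δ p ew ρw m)))))) ⟩
    ∂ᵀ⟨ m ∣ coeff p ⟩               ∎
    where open ≡-Reasoning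

  ∂ᵀ-cong : ∀ m {c c′} → (∀ u → c u ≡ c′ u) → ∂ᵀ⟨ m ∣ c ⟩ ≡ ∂ᵀ⟨ m ∣ c′ ⟩
  ∂ᵀ-cong m {c} {c′} c≗c′ = cong₂ _+_ (term ex ρx) (cong₂ _+_ (term ey ρy) (cong₂ _+_ (term ez ρz) (term ew ρw)))
    where
    term : ∀ (e : Mon → ℤ) ρ → e (m ·ₘ ρ ⁻¹ₘ) * c (m ·ₘ ρ ⁻¹ₘ) ≡ e (m ·ₘ ρ ⁻¹ₘ) * c′ (m ·ₘ ρ ⁻¹ₘ)
    term e ρ = cong (e (m ·ₘ ρ ⁻¹ₘ) *_) (c≗c′ (m ·ₘ ρ ⁻¹ₘ))

  D-cong : ∀ {p q} → p ≃ q → D p ≃ D q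
  D-cong {p} {q} p≃q = coeffwise λ m →
    trans (coeff-D p m) (trans (∂ᵀ-cong m (coeffs p≃q)) (sym (coeff-D q m)))

  dropZeros : Poly → Poly
  dropZeros = filter (λ t → ¬? (proj₁ t ℤ.≟ 0ℤ))

  dropZeros-≃ : ∀ p → dropZeros p ≃ p
  dropZeros-≃ p = coeffwise (coeff-dropZeros p)
    where
    coeff-dropZeros : ∀ p m → coeff (dropZeros p) m ≡ coeff p m
    coeff-dropZeros []             m = refl
    coeff-dropZeros ((c , m′) ∷ p) m with c ℤ.≟ 0ℤ
    ... | yes refl = trans (coeff-dropZeros p m) (sym (trans (cong (_+ coeff p m) (if-0 (m′ =ₘ m))) (ℤP.+-identityˡ _)))
      where if-0 : ∀ b → (if b then 0ℤ else 0ℤ) ≡ 0ℤ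
            if-0 true  = refl
            if-0 false = refl
    ... | no _     = cong (_+_ (if m′ =ₘ m then c else 0ℤ)) (coeff-dropZeros p m)

  -- D X computes to X ⊗ Y padded with terms of coefficient 0, which dropZeros removes; similarly for Y, Z, W.
  D-x : D X ≃ (X ⊗ Y)
  D-x = ≃.sym (dropZeros-≃ (D X))

  D-y : D Y ≃ (X ⊗ Z)
  D-y = ≃.sym (dropZeros-≃ (D Y))

  D-z : D Z ≃ (Z ⊗ W)
  D-z = ≃.sym (dropZeros-≃ (D Z))

  D-w : D W ≃ (X ⊗ Z)
  D-w = ≃.sym (dropZeros-≃ (D W))

  cst-+ : ∀ a b → cst (a + b) ≃ (cst a ⊕ cst b)
  cst-+ a b = coeffwise λ m → if-+ (1ₘ =ₘ m)
    where
    if-+ : ∀ t → (if t then a + b else 0ℤ) + 0ℤ ≡ (if t then a else 0ℤ) + ((if t then b else 0ℤ) + 0ℤ)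
    if-+ true  = trans (ℤP.+-identityʳ _) (cong (_+_ a) (sym (ℤP.+-identityʳ b)))
    if-+ false = refl

open LaurentPolynomials

module QuadraticExtension {c ℓ} (R : CommutativeRing c ℓ) (d : CommutativeRing.Carrier R) where

  open CommutativeRing R
  open import Data.Product using (_×_)
  open ℤ-CoefficientSolver R using (solve; _:+_; _:*_; _:=_; con)

  R[√d] : Set c
  R[√d] = Carrier × Carrier

  infix 4 _≈²_
  record _≈²_ (u v : R[√d]) : Set ℓ where
    constructor _,_
    field
      proj₁≈ : proj₁ u ≈ proj₁ v
      proj₂≈ : proj₂ u ≈ proj₂ v
  open _≈²_ public

  infixl 6 _+²_
  infixl 7 _*²_
  _+²_ : R[√d] → R[√d] → R[√d]
  (a , b) +² (a′ , b′) = (a + a′ , b + b′)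

  _*²_ : R[√d] → R[√d] → R[√d]
  (a , b) *² (a′ , b′) = (a * a′ + (b * b′) * d , a * b′ + b * a′)

  -²_ : R[√d] → R[√d]
  -² (a , b) = (- a , - b)

  embed : Carrier → R[√d]
  embed a = (a , 0#)

  √d : R[√d]
  √d = (0# , 1#)

  commutativeRing : CommutativeRing c ℓ
  commutativeRing = record
    { Carrier = R[√d] ; _≈_ = _≈²_ ; _+_ = _+²_ ; _*_ = _*²_ ; -_ = -²_ ; 0# = embed 0# ; 1# = embed 1#
    ; isCommutativeRing = record
      { isRing = record
        { +-isAbelianGroup = record
          { isGroup = record
            { isMonoid = record
              { isSemigroup = record
                { isMagma = record
                  { isEquivalence = record
                    { refl  = refl , refl
                    ; sym   = λ (e , f) → sym e , sym f
                    ; trans = λ (e , f) (e′ , f′) → trans e e′ , trans f f′ }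
                  ; ∙-cong = λ (e , f) (e′ , f′) → +-cong e e′ , +-cong f f′ }
                ; assoc = λ (a , b) (a′ , b′) (a″ , b″) → +-assoc a a′ a″ , +-assoc b b′ b″ }
              ; identity = (λ (a , b) → +-identityˡ a , +-identityˡ b) , (λ (a , b) → +-identityʳ a , +-identityʳ b) }
            ; inverse = (λ (a , b) → -‿inverseˡ a , -‿inverseˡ b) , (λ (a , b) → -‿inverseʳ a , -‿inverseʳ b)
            ; ⁻¹-cong = λ (e , f) → -‿cong e , -‿cong f }
          ; comm = λ (a , b) (a′ , b′) → +-comm a a′ , +-comm b b′ }
        ; *-cong = λ (e , f) (e′ , f′) → +-cong (*-cong e e′) (*-congʳ (*-cong f f′)) , +-cong (*-cong e f′) (*-cong f e′)
        ; *-assoc = λ (a , b) (a′ , b′) (a″ , b″) → assoc₁ a b a′ b′ a″ b″ d , assoc₂ a b a′ b′ a″ b″ d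
        ; *-identity = (λ (a , b) → identityˡ₁ a b d , identityˡ₂ a b) , (λ (a , b) → identityʳ₁ a b d , identityʳ₂ a b)
        ; distrib = (λ (a , b) (a′ , b′) (a″ , b″) → distribˡ₁ a b a′ b′ a″ b″ d , distribˡ₂ a b a′ b′ a″ b″)
                  , (λ (a , b) (a′ , b′) (a″ , b″) → distribʳ₁ a b a′ b′ a″ b″ d , distribʳ₂ a b a′ b′ a″ b″) }
      ; *-comm = λ (a , b) (a′ , b′) → comm₁ a b a′ b′ d , comm₂ a b a′ b′ } }
    where
    assoc₁ = solve 7 (λ a b c e f g D → (a :* c :+ (b :* e) :* D) :* f :+ ((a :* e :+ b :* c) :* g) :* D
                                     := a :* (c :* f :+ (e :* g) :* D) :+ (b :* (c :* g :+ e :* f)) :* D) refl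
    assoc₂ = solve 7 (λ a b c e f g D → (a :* c :+ (b :* e) :* D) :* g :+ (a :* e :+ b :* c) :* f
                                     := a :* (c :* g :+ e :* f) :+ b :* (c :* f :+ (e :* g) :* D)) refl
    identityˡ₁ = solve 3 (λ a b D → con (+ 1) :* a :+ (con (+ 0) :* b) :* D := a) refl
    identityˡ₂ = solve 2 (λ a b → con (+ 1) :* b :+ con (+ 0) :* a := b) refl
    identityʳ₁ = solve 3 (λ a b D → a :* con (+ 1) :+ (b :* con (+ 0)) :* D := a) refl
    identityʳ₂ = solve 2 (λ a b → a :* con (+ 0) :+ b :* con (+ 1) := b) refl
    distribˡ₁ = solve 7 (λ a b c e f g D → a :* (c :+ f) :+ (b :* (e :+ g)) :* D
                                        := (a :* c :+ (b :* e) :* D) :+ (a :* f :+ (b :* g) :* D)) refl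
    distribˡ₂ = solve 6 (λ a b c e f g → a :* (e :+ g) :+ b :* (c :+ f) := (a :* e :+ b :* c) :+ (a :* g :+ b :* f)) refl
    distribʳ₁ = solve 7 (λ a b c e f g D → (c :+ f) :* a :+ ((e :+ g) :* b) :* D
                                        := (c :* a :+ (e :* b) :* D) :+ (f :* a :+ (g :* b) :* D)) refl
    distribʳ₂ = solve 6 (λ a b c e f g → (c :+ f) :* b :+ (e :+ g) :* a := (c :* b :+ e :* a) :+ (f :* b :+ g :* a)) refl
    comm₁ = solve 5 (λ a b c e D → a :* c :+ (b :* e) :* D := c :* a :+ (e :* b) :* D) refl
    comm₂ = solve 4 (λ a b c e → a :* e :+ b :* c := c :* b :+ e :* a) refl

  embed-cong : ∀ {a b} → a ≈ b → embed a ≈² embed b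
  embed-cong a≈b = a≈b , refl

  embed-+ : ∀ a b → embed (a + b) ≈² embed a +² embed b
  embed-+ a b = refl , sym (+-identityʳ 0#)

  embed-* : ∀ a b → embed (a * b) ≈² embed a *² embed b
  embed-* a b = first a b d , second a b
    where
    first  = solve 3 (λ a b D → a :* b := a :* b :+ (con (+ 0) :* con (+ 0)) :* D) refl
    second = solve 2 (λ a b → con (+ 0) := a :* con (+ 0) :+ con (+ 0) :* b) refl

  embed-neg : ∀ a → embed (- a) ≈² -² embed a
  embed-neg a = refl , sym (-0#≈0#)
    where open import Algebra.Properties.Ring ring using (-0#≈0#)

  √d*√d : √d *² √d ≈² embed d
  √d*√d = first d , second
    where
    first  = solve 1 (λ D → con (+ 0) :* con (+ 0) :+ (con (+ 1) :* con (+ 1)) :* D := D) refl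
    second = solve 0 (con (+ 0) :* con (+ 1) :+ con (+ 1) :* con (+ 0) := con (+ 0)) refl

module RiccatiLinearisation {c ℓ} (R : CommutativeRing c ℓ) where

  open CommutativeRing R
  open ℤ-CoefficientSolver R using (solve; _:+_; _:*_; _:-_; :-_; _:=_; con)
  open import Relation.Binary.Reasoning.Setoid setoid

  -- These are the values the solver assigns to the constants 2 and 4.
  2# 4# : Carrier
  2# = 1# + 1#
  4# = 2# + 1# + 1#

  -- If f′ = f² + a f + x, e′ = d e and d² = a² − 4x, then P = f·den − num satisfies 2P′ = (2f + a + d)·P.
  linearisation : ∀ f e a d x → d * d ≈ a * a - 4# * x →
    let den = (a + d) + - (a - d) * e
        num = - (2# * x) + 2# * x * e
    in 2# * ((f * f + a * f + x) * den + f * (- (a - d) * (d * e)) - 2# * x * (d * e))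
       ≈ (2# * f + a + d) * (f * den - num)
  linearisation f e a d x d²≈a²-4x = begin
    2# * ((f * f + a * f + x) * den + f * (- (a - d) * (d * e)) - 2# * x * (d * e))
      ≈⟨ expand f e a d x ⟩
    (2# * f + a + d) * (f * den - num) + (d * d - a * a + 4# * x) * ((e - 1#) * f)
      ≈⟨ +-congˡ (*-congʳ (trans (+-congʳ (+-congʳ d²≈a²-4x)) (cancel a x))) ⟩
    (2# * f + a + d) * (f * den - num) + 0# * ((e - 1#) * f)
      ≈⟨ trans (+-congˡ (zeroˡ _)) (+-identityʳ _) ⟩
    (2# * f + a + d) * (f * den - num) ∎
    where
    den = (a + d) + - (a - d) * e
    num = - (2# * x) + 2# * x * e
    expand = solve 5 (λ f e a d x →
      con (+ 2) :* ((f :* f :+ a :* f :+ x) :* ((a :+ d) :+ :- (a :- d) :* e) :+ f :* (:- (a :- d) :* (d :* e))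
                    :- con (+ 2) :* x :* (d :* e))
      := (con (+ 2) :* f :+ a :+ d) :* (f :* ((a :+ d) :+ :- (a :- d) :* e) :- (:- (con (+ 2) :* x) :+ con (+ 2) :* x :* e))
         :+ (d :* d :- a :* a :+ con (+ 4) :* x) :* ((e :- con (+ 1)) :* f)) refl
    cancel = solve 2 (λ a x → (a :* a :- con (+ 4) :* x) :- a :* a :+ con (+ 4) :* x := con (+ 0)) refl

module ExponentialSeries {c ℓ} (R : CommutativeRing c ℓ) (nat : ℕ → CommutativeRing.Carrier R)
  (nat-0   : CommutativeRing._≈_ R (nat 0) (CommutativeRing.0# R))
  (nat-suc : ∀ n → CommutativeRing._≈_ R (nat (suc n)) (CommutativeRing._+_ R (CommutativeRing.1# R) (nat n)))
  where

  open CommutativeRing R hiding (zero)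

  open import Algebra.Properties.Semiring.Sum semiring
    using (sum; sum-cong-≋; ∑-distrib-+; sum-init-last; sum-replicate-zero)
  open import Relation.Binary.Reasoning.Setoid setoid

  Series : Set c
  Series = ℕ → Carrier

  infixl 10 _′
  _′ : Series → Series
  (a ′) n = a (suc n)

  infixl 7 _⋆_
  _⋆_ : Series → Series → Series
  (a ⋆ b) n = foldr (λ k acc → (nat (n C k) * (a k * b (n ∸ k))) + acc) 0# (upTo (suc n))

  nat-+ : ∀ m n → nat (m ℕ.+ n) ≈ nat m + nat n
  nat-+ zero    n = sym (trans (+-congʳ nat-0) (+-identityˡ _))
  nat-+ (suc m) n = begin
    nat (suc (m ℕ.+ n))     ≈⟨ nat-suc (m ℕ.+ n) ⟩
    1# + nat (m ℕ.+ n)      ≈⟨ +-congˡ (nat-+ m n) ⟩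
    1# + (nat m + nat n)    ≈⟨ +-assoc 1# _ _ ⟨
    (1# + nat m) + nat n    ≈⟨ +-congʳ (nat-suc m) ⟨
    nat (suc m) + nat n     ∎

  nat-1 : nat 1 ≈ 1#
  nat-1 = trans (nat-suc 0) (trans (+-congˡ nat-0) (+-identityʳ 1#))

  ∑< : ℕ → (ℕ → Carrier) → Carrier
  ∑< n f = sum (λ (j : Fin n) → f (toℕ j))

  ∑<-cong : ∀ n {f g} → (∀ k → k < n → f k ≈ g k) → ∑< n f ≈ ∑< n g
  ∑<-cong n f≈g = sum-cong-≋ {n} (λ j → f≈g (toℕ j) (FinP.toℕ<n j))

  ∑<-+ : ∀ n f g → ∑< n (λ k → f k + g k) ≈ ∑< n f + ∑< n g
  ∑<-+ n f g = ∑-distrib-+ {n} (λ j → f (toℕ j)) (λ j → g (toℕ j))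

  ∑<-dropLast : ∀ n f → f n ≈ 0# → ∑< (suc n) f ≈ ∑< n f
  ∑<-dropLast n f fn≈0 = begin
    ∑< (suc n) f                                          ≈⟨ sum-init-last {n} (λ j → f (toℕ j)) ⟩
    sum (λ (j : Fin n) → f (toℕ (inject₁ j))) + f (toℕ (fromℕ n))
      ≈⟨ +-cong (sum-cong-≋ {n} (λ j → reflexive (≡.cong f (FinP.toℕ-inject₁ j))))
                (trans (reflexive (≡.cong f (FinP.toℕ-fromℕ n))) fn≈0) ⟩
    ∑< n f + 0#                                           ≈⟨ +-identityʳ _ ⟩
    ∑< n f                                                ∎

  ∑<-zero : ∀ n f → (∀ k → k < n → f k ≈ 0#) → ∑< n f ≈ 0#
  ∑<-zero n f f≈0 = trans (∑<-cong n f≈0) (sum-replicate-zero n)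

  term : Series → Series → ℕ → ℕ → Carrier
  term a b n k = nat (n C k) * (a k * b (n ∸ k))

  ⋆-as-sum : ∀ a b n → (a ⋆ b) n ≡.≡ ∑< (suc n) (term a b n)
  ⋆-as-sum a b n = foldr-applyUpTo id (suc n)
    where
    foldr-applyUpTo : ∀ (g : ℕ → ℕ) m →
      foldr (λ k acc → term a b n k + acc) 0# (applyUpTo g m) ≡.≡ ∑< m (term a b n ∘ g)
    foldr-applyUpTo g zero    = ≡.refl
    foldr-applyUpTo g (suc m) = ≡.cong (_+_ (term a b n (g 0))) (foldr-applyUpTo (g ∘ suc) m)

  ⋆-leibniz : ∀ a b n → (a ⋆ b) (suc n) ≈ (a ′ ⋆ b) n + (a ⋆ b ′) n
  ⋆-leibniz a b n = begin
    (a ⋆ b) (suc n)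
      ≡⟨ ⋆-as-sum a b (suc n) ⟩
    t₀ + ∑< (suc n) (λ k → term a b (suc n) (suc k))
      ≈⟨ +-congˡ (∑<-cong (suc n) (λ k _ → pascal k)) ⟩
    t₀ + ∑< (suc n) (λ k → term (a ′) b n k + T k)
      ≈⟨ +-congˡ (∑<-+ (suc n) (term (a ′) b n) T) ⟩
    t₀ + (∑< (suc n) (term (a ′) b n) + ∑< (suc n) T)
      ≈⟨ x+[y+z]≈y+[x+z] t₀ _ _ ⟩
    ∑< (suc n) (term (a ′) b n) + (t₀ + ∑< (suc n) T)
      ≈⟨ +-congˡ (+-congˡ (trans (∑<-dropLast n T Tn≈0) (∑<-cong n T-shift))) ⟩
    ∑< (suc n) (term (a ′) b n) + (t₀ + ∑< n (λ k → term a (b ′) n (suc k)))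
      ≡⟨ ≡.cong₂ _+_ (⋆-as-sum (a ′) b n) (⋆-as-sum a (b ′) n) ⟨
    (a ′ ⋆ b) n + (a ⋆ b ′) n ∎
    where
    t₀ = term a b (suc n) 0
    T : ℕ → Carrier
    T k = nat (n C suc k) * (a (suc k) * b (n ∸ k))
    pascal : ∀ k → term a b (suc n) (suc k) ≈ term (a ′) b n k + T k
    pascal k = begin
      nat (suc n C suc k) * (a (suc k) * b (n ∸ k))
        ≡⟨ ≡.cong (λ i → nat i * (a (suc k) * b (n ∸ k))) (nCk+nC[k+1]≡[n+1]C[k+1] n k) ⟨
      nat (n C k ℕ.+ n C suc k) * (a (suc k) * b (n ∸ k))
        ≈⟨ *-congʳ (nat-+ (n C k) (n C suc k)) ⟩
      (nat (n C k) + nat (n C suc k)) * (a (suc k) * b (n ∸ k))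
        ≈⟨ distribʳ _ _ _ ⟩
      term (a ′) b n k + T k ∎
    Tn≈0 : T n ≈ 0#
    Tn≈0 = trans (*-congʳ (trans (reflexive (≡.cong nat (k>n⇒nCk≡0 (ℕP.n<1+n n)))) nat-0)) (zeroˡ _)
    T-shift : ∀ k → k < n → T k ≈ term a (b ′) n (suc k)
    T-shift k k<n = reflexive (≡.cong (λ i → nat (n C suc k) * (a (suc k) * b i)) (ℕP.+-∸-assoc 1 k<n))
    x+[y+z]≈y+[x+z] : ∀ x y z → x + (y + z) ≈ y + (x + z)
    x+[y+z]≈y+[x+z] x y z = trans (sym (+-assoc x y z)) (trans (+-congʳ (+-comm x y)) (+-assoc y x z))

  ⋆-zero-index : ∀ a b → (a ⋆ b) 0 ≈ a 0 * b 0
  ⋆-zero-index a b = trans (+-identityʳ _) (trans (*-congʳ nat-1) (*-identityˡ _))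

  ⋆-vanish : ∀ a b n → (∀ k → k ≤ n → b k ≈ 0#) → (a ⋆ b) n ≈ 0#
  ⋆-vanish a b n b≈0 = begin
    (a ⋆ b) n              ≡⟨ ⋆-as-sum a b n ⟩
    ∑< (suc n) (term a b n) ≈⟨ ∑<-zero (suc n) (term a b n) (λ k _ → term≈0 k) ⟩
    0#                     ∎
    where
    term≈0 : ∀ k → term a b n k ≈ 0#
    term≈0 k = trans (*-congˡ (trans (*-congˡ (b≈0 (n ∸ k) (ℕP.m∸n≤m n k))) (zeroʳ _))) (zeroʳ _)

  infix 4 _≋_
  record _≋_ (a b : Series) : Set ℓ where
    constructor pointwise
    field at : ∀ n → a n ≈ b n
  open _≋_ public

  ≋-setoid : Setoid c ℓ
  ≋-setoid = record
    { Carrier = Series ; _≈_ = _≋_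
    ; isEquivalence = record
      { refl  = pointwise λ _ → refl
      ; sym   = λ a≋b → pointwise λ n → sym (at a≋b n)
      ; trans = λ a≋b b≋c → pointwise λ n → trans (at a≋b n) (at b≋c n) } }

  infixl 6 _+ₛ_
  _+ₛ_ : Series → Series → Series
  (a +ₛ b) n = a n + b n

  infix 8 -ₛ_
  -ₛ_ : Series → Series
  (-ₛ a) n = - a n

  infixl 6 _-ₛ_
  _-ₛ_ : Series → Series → Series
  a -ₛ b = a +ₛ -ₛ b

  0ₛ : Series
  0ₛ _ = 0#

  const : Carrier → Series
  const x zero    = x
  const x (suc _) = 0#

  ⋆-cong : ∀ {a a′ b b′} → a ≋ a′ → b ≋ b′ → a ⋆ b ≋ a′ ⋆ b′
  ⋆-cong {a} {a′} {b} {b′} a≋a′ b≋b′ = pointwise λ n → begin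
    (a ⋆ b) n                ≡⟨ ⋆-as-sum a b n ⟩
    ∑< (suc n) (term a b n)   ≈⟨ ∑<-cong (suc n) (λ k _ → *-congˡ {nat (n C k)} (*-cong (at a≋a′ k) (at b≋b′ (n ∸ k)))) ⟩
    ∑< (suc n) (term a′ b′ n) ≡⟨ ⋆-as-sum a′ b′ n ⟨
    (a′ ⋆ b′) n              ∎

  const-⋆ : ∀ x a n → (const x ⋆ a) n ≈ x * a n
  const-⋆ x a n = begin
    (const x ⋆ a) n                                        ≡⟨ ⋆-as-sum (const x) a n ⟩
    nat 1 * (x * a n) + ∑< n (λ k → term (const x) a n (suc k)) ≈⟨ +-cong (trans (*-congʳ nat-1) (*-identityˡ _))
                                                                        (∑<-zero n _ (λ k _ → trans (*-congˡ {nat (n C suc k)} (zeroˡ (a (n ∸ suc k)))) (zeroʳ _))) ⟩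
    x * a n + 0#                                           ≈⟨ +-identityʳ _ ⟩
    x * a n                                                ∎

  ⋆-distribʳ : ∀ a b c → (b +ₛ c) ⋆ a ≋ (b ⋆ a) +ₛ (c ⋆ a)
  ⋆-distribʳ a b c = pointwise λ n → begin
    ((b +ₛ c) ⋆ a) n                                   ≡⟨ ⋆-as-sum (b +ₛ c) a n ⟩
    ∑< (suc n) (term (b +ₛ c) a n)                      ≈⟨ ∑<-cong (suc n) (λ k _ → trans (*-congˡ {nat (n C k)} (distribʳ (a (n ∸ k)) (b k) (c k))) (distribˡ _ _ _)) ⟩
    ∑< (suc n) (λ k → term b a n k + term c a n k)      ≈⟨ ∑<-+ (suc n) (term b a n) (term c a n) ⟩
    ∑< (suc n) (term b a n) + ∑< (suc n) (term c a n)   ≡⟨ ≡.cong₂ _+_ (⋆-as-sum b a n) (⋆-as-sum c a n) ⟨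
    (b ⋆ a) n + (c ⋆ a) n                              ∎

  ⋆-commₙ : ∀ n a b → (a ⋆ b) n ≈ (b ⋆ a) n
  ⋆-commₙ zero    a b = trans (⋆-zero-index a b) (trans (*-comm _ _) (sym (⋆-zero-index b a)))
  ⋆-commₙ (suc n) a b = begin
    (a ⋆ b) (suc n)              ≈⟨ ⋆-leibniz a b n ⟩
    (a ′ ⋆ b) n + (a ⋆ b ′) n    ≈⟨ +-cong (⋆-commₙ n (a ′) b) (⋆-commₙ n a (b ′)) ⟩
    (b ⋆ a ′) n + (b ′ ⋆ a) n    ≈⟨ +-comm _ _ ⟩
    (b ′ ⋆ a) n + (b ⋆ a ′) n    ≈⟨ ⋆-leibniz b a n ⟨
    (b ⋆ a) (suc n)              ∎

  ⋆-comm : ∀ a b → a ⋆ b ≋ b ⋆ a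
  ⋆-comm a b = pointwise λ n → ⋆-commₙ n a b

  ⋆-distribˡ : ∀ a b c → a ⋆ (b +ₛ c) ≋ (a ⋆ b) +ₛ (a ⋆ c)
  ⋆-distribˡ a b c = pointwise λ n →
    trans (⋆-commₙ n a (b +ₛ c)) (trans (at (⋆-distribʳ a b c) n) (+-cong (⋆-commₙ n b a) (⋆-commₙ n c a)))

  ⋆-assocₙ : ∀ n a b c → ((a ⋆ b) ⋆ c) n ≈ (a ⋆ (b ⋆ c)) n
  ⋆-assocₙ zero a b c = begin
    ((a ⋆ b) ⋆ c) 0        ≈⟨ trans (⋆-zero-index (a ⋆ b) c) (*-congʳ (⋆-zero-index a b)) ⟩
    (a 0 * b 0) * c 0      ≈⟨ *-assoc _ _ _ ⟩
    a 0 * (b 0 * c 0)      ≈⟨ trans (⋆-zero-index a (b ⋆ c)) (*-congˡ (⋆-zero-index b c)) ⟨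
    (a ⋆ (b ⋆ c)) 0        ∎
  ⋆-assocₙ (suc n) a b c = begin
    ((a ⋆ b) ⋆ c) (suc n)
      ≈⟨ ⋆-leibniz (a ⋆ b) c n ⟩
    ((a ⋆ b) ′ ⋆ c) n + ((a ⋆ b) ⋆ c ′) n
      ≈⟨ +-congʳ (at (⋆-cong {b = c} (pointwise (⋆-leibniz a b)) (pointwise λ _ → refl)) n) ⟩
    ((a ′ ⋆ b +ₛ a ⋆ b ′) ⋆ c) n + ((a ⋆ b) ⋆ c ′) n
      ≈⟨ +-congʳ (at (⋆-distribʳ c (a ′ ⋆ b) (a ⋆ b ′)) n) ⟩
    (((a ′ ⋆ b) ⋆ c) n + ((a ⋆ b ′) ⋆ c) n) + ((a ⋆ b) ⋆ c ′) n
      ≈⟨ +-cong (+-cong (⋆-assocₙ n (a ′) b c) (⋆-assocₙ n a (b ′) c)) (⋆-assocₙ n a b (c ′)) ⟩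
    ((a ′ ⋆ (b ⋆ c)) n + (a ⋆ (b ′ ⋆ c)) n) + (a ⋆ (b ⋆ c ′)) n
      ≈⟨ +-assoc _ _ _ ⟩
    (a ′ ⋆ (b ⋆ c)) n + ((a ⋆ (b ′ ⋆ c)) n + (a ⋆ (b ⋆ c ′)) n)
      ≈⟨ +-congˡ (at (⋆-distribˡ a (b ′ ⋆ c) (b ⋆ c ′)) n) ⟨
    (a ′ ⋆ (b ⋆ c)) n + (a ⋆ (b ′ ⋆ c +ₛ b ⋆ c ′)) n
      ≈⟨ +-congˡ (at (⋆-cong {a = a} (pointwise λ _ → refl) (pointwise (⋆-leibniz b c))) n) ⟨
    (a ′ ⋆ (b ⋆ c)) n + (a ⋆ (b ⋆ c) ′) n
      ≈⟨ ⋆-leibniz a (b ⋆ c) n ⟨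
    (a ⋆ (b ⋆ c)) (suc n) ∎

  seriesRing : CommutativeRing c ℓ
  seriesRing = record
    { Carrier = Series ; _≈_ = _≋_ ; _+_ = _+ₛ_ ; _*_ = _⋆_ ; -_ = -ₛ_ ; 0# = 0ₛ ; 1# = const 1#
    ; isCommutativeRing = record
      { isRing = record
        { +-isAbelianGroup = record
          { isGroup = record
            { isMonoid = record
              { isSemigroup = record
                { isMagma = record
                  { isEquivalence = Setoid.isEquivalence ≋-setoid
                  ; ∙-cong = λ a≋a′ b≋b′ → pointwise λ n → +-cong (at a≋a′ n) (at b≋b′ n) }
                ; assoc = λ a b c → pointwise λ n → +-assoc (a n) (b n) (c n) }
              ; identity = (λ a → pointwise λ n → +-identityˡ (a n)) , (λ a → pointwise λ n → +-identityʳ (a n)) }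
            ; inverse = (λ a → pointwise λ n → -‿inverseˡ (a n)) , (λ a → pointwise λ n → -‿inverseʳ (a n))
            ; ⁻¹-cong = λ a≋b → pointwise λ n → -‿cong (at a≋b n) }
          ; comm = λ a b → pointwise λ n → +-comm (a n) (b n) }
        ; *-cong = ⋆-cong
        ; *-assoc = λ a b c → pointwise λ n → ⋆-assocₙ n a b c
        ; *-identity = comm∧idˡ⇒id ⋆-comm (λ a → pointwise λ n → trans (const-⋆ 1# a n) (*-identityˡ (a n)))
        ; distrib = ⋆-distribˡ , λ a b c → ⋆-distribʳ a b c }
      ; *-comm = ⋆-comm } }
    where open Consequences ≋-setoid

  ′-leibniz : ∀ a b → (a ⋆ b) ′ ≋ a ′ ⋆ b +ₛ a ⋆ b ′
  ′-leibniz a b = pointwise (⋆-leibniz a b)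

  ′-cong : ∀ {a b} → a ≋ b → a ′ ≋ b ′
  ′-cong a≋b = pointwise λ n → at a≋b (suc n)

  const-′ : ∀ x → const x ′ ≋ 0ₛ
  const-′ x = pointwise λ _ → refl

  ′≋0⇒≋0 : ∀ a → a ′ ≋ 0ₛ → a 0 ≈ 0# → a ≋ 0ₛ
  ′≋0⇒≋0 a a′≋0 a₀≈0 = pointwise λ { zero → a₀≈0 ; (suc n) → at a′≋0 n }

  const-cong : ∀ {x y} → x ≈ y → const x ≋ const y
  const-cong x≈y = pointwise λ { zero → x≈y ; (suc n) → refl }

  const-+ : ∀ x y → const (x + y) ≋ const x +ₛ const y
  const-+ x y = pointwise λ { zero → refl ; (suc n) → sym (+-identityʳ 0#) }

  const-* : ∀ x y → const (x * y) ≋ const x ⋆ const y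
  const-* x y = pointwise λ { zero → sym (const-⋆ x (const y) zero) ; (suc n) → sym (trans (const-⋆ x (const y) (suc n)) (zeroʳ x)) }

  const-neg : ∀ x → const (- x) ≋ -ₛ const x
  const-neg x = pointwise λ { zero → refl ; (suc n) → sym -0#≈0# }
    where open import Algebra.Properties.Ring ring using (-0#≈0#)

  open import Algebra.Properties.Semiring.Mult.TCOptimised (CommutativeRing.semiring seriesRing)
    using () renaming (_×_ to _×ₛ_; 1+× to 1+×ₛ)

  const-nat : ∀ n → const (nat n) ≋ n ×ₛ const 1#
  const-nat zero    = pointwise λ { zero → nat-0 ; (suc n) → refl }
  const-nat (suc n) = pointwise λ k → begin
    const (nat (suc n)) k            ≈⟨ at (const-cong (nat-suc n)) k ⟩
    const (1# + nat n) k             ≈⟨ at (const-+ 1# (nat n)) k ⟩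
    const 1# k + const (nat n) k     ≈⟨ +-congˡ (at (const-nat n) k) ⟩
    const 1# k + (n ×ₛ const 1#) k   ≈⟨ at (1+×ₛ n (const 1#)) k ⟨
    (suc n ×ₛ const 1#) k            ∎

  affine-′ : ∀ x y a → (const x +ₛ const y ⋆ a) ′ ≋ const y ⋆ a ′
  affine-′ x y a = pointwise λ n → begin
    0# + (const y ⋆ a) (suc n)  ≈⟨ +-identityˡ _ ⟩
    (const y ⋆ a) (suc n)       ≈⟨ const-⋆ y a (suc n) ⟩
    y * a (suc n)               ≈⟨ const-⋆ y (a ′) n ⟨
    (const y ⋆ a ′) n           ∎

  linear-ode-uniqueness : ∀ κ → (∀ u → κ * u ≈ 0# → u ≈ 0#) →
                          ∀ p q → const κ ⋆ p ′ ≋ q ⋆ p → p 0 ≈ 0# → p ≋ 0ₛ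
  linear-ode-uniqueness κ κ-cancel p q ode p₀≈0 = pointwise λ n → vanish n n ℕP.≤-refl
    where
    vanish : ∀ n k → k ≤ n → p k ≈ 0#
    vanish zero    zero    _         = p₀≈0
    vanish (suc n) zero    _         = p₀≈0
    vanish (suc n) (suc k) (s≤s k≤n) = κ-cancel (p (suc k)) (begin
      κ * p (suc k)        ≈⟨ const-⋆ κ (p ′) k ⟨
      (const κ ⋆ p ′) k    ≈⟨ at ode k ⟩
      (q ⋆ p) k            ≈⟨ ⋆-vanish q p k (λ j j≤k → vanish n j (ℕP.≤-trans j≤k k≤n)) ⟩
      0#                   ∎)

module Q = QuadraticExtension polyRing disc
module RΔ = CommutativeRing Q.commutativeRing
open Q using (_,_)

natΔ-0 : natΔ 0 RΔ.≈ 0Δ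
natΔ-0 = ≃.sym (dropZeros-≃ (cst 0ℤ)) , ≃.refl

natΔ-suc : ∀ n → natΔ (suc n) RΔ.≈ (RΔ.1# +Δ natΔ n)
natΔ-suc n = cst-+ 1ℤ (+ n) , ≃.refl

-- With these parameters S._⋆_ is egfMul, and Q's ring operations and embedding are Defs' _+Δ_,
-- _*Δ_, -Δ_ and ι, all definitionally.
module S = ExponentialSeries Q.commutativeRing natΔ natΔ-0 natΔ-suc
open S using (Series; _′; _⋆_; _+ₛ_; _-ₛ_; -ₛ_; 0ₛ; const; _≋_; pointwise; at)
module 𝕊 = CommutativeRing S.seriesRing

D^-cong : ∀ n {p q} → p ≃ q → D^ n p ≃ D^ n q
D^-cong zero    p≃q = p≃q
D^-cong (suc n) p≃q = D-cong (D^-cong n p≃q)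

D^-⊕ : ∀ n p q → D^ n (p ⊕ q) ≃ (D^ n p ⊕ D^ n q)
D^-⊕ zero    p q = ≃.refl
D^-⊕ (suc n) p q = ≃.trans (D-cong (D^-⊕ n p q)) (D-⊕ (D^ n p) (D^ n q))

D^-suc : ∀ n p → D^ (suc n) p ≡ D^ n (D p)
D^-suc zero    p = ≡.refl
D^-suc (suc n) p = ≡.cong D (D^-suc n p)

Gen : Poly → Series
Gen p n = ι (D^ n p)

Gen-cong : ∀ {p q} → p ≃ q → Gen p ≋ Gen q
Gen-cong p≃q = pointwise λ n → Q.embed-cong (D^-cong n p≃q)

Gen-′ : ∀ p → Gen p ′ ≋ Gen (D p)
Gen-′ p = pointwise λ n → RΔ.reflexive (≡.cong ι (D^-suc n p))

Gen-⊕ : ∀ p q → Gen (p ⊕ q) ≋ (Gen p +ₛ Gen q)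
Gen-⊕ p q = pointwise λ n → RΔ.trans (Q.embed-cong (D^-⊕ n p q)) (Q.embed-+ (D^ n p) (D^ n q))

Gen-⊗ : ∀ p q → Gen (p ⊗ q) ≋ (Gen p ⋆ Gen q)
Gen-⊗ p q = pointwise λ n → Gen-⊗-at n p q
  where
  open import Relation.Binary.Reasoning.Setoid RΔ.setoid
  Gen-⊗-at : ∀ n p q → Gen (p ⊗ q) n RΔ.≈ (Gen p ⋆ Gen q) n
  Gen-⊗-at zero    p q = RΔ.trans (Q.embed-* p q) (RΔ.sym (S.⋆-zero-index (Gen p) (Gen q)))
  Gen-⊗-at (suc n) p q = begin
    Gen (p ⊗ q) (suc n)                              ≈⟨ at (Gen-′ (p ⊗ q)) n ⟩
    Gen (D (p ⊗ q)) n                                ≈⟨ at (Gen-cong (D-leibniz p q)) n ⟩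
    Gen ((D p ⊗ q) ⊕ (p ⊗ D q)) n                    ≈⟨ at (Gen-⊕ (D p ⊗ q) (p ⊗ D q)) n ⟩
    Gen (D p ⊗ q) n +Δ Gen (p ⊗ D q) n               ≈⟨ RΔ.+-cong (Gen-⊗-at n (D p) q) (Gen-⊗-at n p (D q)) ⟩
    (Gen (D p) ⋆ Gen q) n +Δ (Gen p ⋆ Gen (D q)) n
      ≈⟨ RΔ.+-cong (at (S.⋆-cong {b = Gen q} (Gen-′ p) (pointwise λ _ → RΔ.refl)) n)
                   (at (S.⋆-cong {a = Gen p} (pointwise λ _ → RΔ.refl) (Gen-′ q)) n) ⟨
    (Gen p ′ ⋆ Gen q) n +Δ (Gen p ⋆ Gen q ′) n ≈⟨ S.⋆-leibniz (Gen p) (Gen q) n ⟨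
    (Gen p ⋆ Gen q) (suc n)                        ∎

Gen-′-rule : ∀ {p q r} → D p ≃ (q ⊗ r) → Gen p ′ ≋ (Gen q ⋆ Gen r)
Gen-′-rule {p} {q} {r} Dp≃qr = pointwise λ n →
  RΔ.trans (at (Gen-′ p) n) (RΔ.trans (at (Gen-cong Dp≃qr) n) (at (Gen-⊗ q r) n))

module 𝕊-solver = ℤ-CoefficientSolver S.seriesRing
module RΔ-solver = ℤ-CoefficientSolver Q.commutativeRing
open RiccatiLinearisation S.seriesRing using (2#; 4#; linearisation)
open import Algebra.Properties.Group 𝕊.+-group using (x∙y⁻¹≈ε⇒x≈y)

gx gy gz gw : Series
gx = Gen X
gy = Gen Y
gz = Gen Z
gw = Gen W

ŷ ŵ Â x̂z Δ̂ : Series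
ŷ  = const (ι Y)
ŵ  = const (ι W)
Â  = const A
x̂z = const xz
Δ̂  = const Δ

gx′ : gx ′ ≋ gx ⋆ gy
gx′ = Gen-′-rule D-x

gy′ : gy ′ ≋ gx ⋆ gz
gy′ = Gen-′-rule D-y

gz′ : gz ′ ≋ gz ⋆ gw
gz′ = Gen-′-rule D-z

gw′ : gw ′ ≋ gx ⋆ gz
gw′ = Gen-′-rule D-w

Â≋ŵ+ŷ : Â ≋ ŵ +ₛ ŷ
Â≋ŵ+ŷ = 𝕊.trans (S.const-cong (Q.embed-+ W Y)) (S.const-+ (ι W) (ι Y))

gw≋gy+ŵ-ŷ : gw ≋ gy +ₛ (ŵ -ₛ ŷ)
gw≋gy+ŵ-ŷ = x∙y⁻¹≈ε⇒x≈y gw (gy +ₛ (ŵ -ₛ ŷ)) (S.′≋0⇒≋0 (gw -ₛ (gy +ₛ (ŵ -ₛ ŷ))) derivative≋0 value≈0)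
  where
  open import Relation.Binary.Reasoning.Setoid S.≋-setoid
  derivative≋0 : gw ′ -ₛ (gy ′ +ₛ (ŵ ′ -ₛ ŷ ′)) ≋ 0ₛ
  derivative≋0 = begin
    gw ′ -ₛ (gy ′ +ₛ (ŵ ′ -ₛ ŷ ′))
      ≈⟨ 𝕊.+-cong gw′ (𝕊.-‿cong (𝕊.+-cong gy′ (𝕊.+-cong (S.const-′ (ι W)) (𝕊.-‿cong (S.const-′ (ι Y)))))) ⟩
    gx ⋆ gz -ₛ (gx ⋆ gz +ₛ (0ₛ -ₛ 0ₛ))
      ≈⟨ 𝕊-solver.solve 1 (λ u → u :- (u :+ (con (+ 0) :- con (+ 0))) := con (+ 0)) 𝕊.refl (gx ⋆ gz) ⟩
    0ₛ ∎
    where open 𝕊-solver using (_:+_; _:-_; _:=_; con)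
  value≈0 : ι W +Δ (-Δ (ι Y +Δ (ι W +Δ (-Δ ι Y)))) RΔ.≈ 0Δ
  value≈0 = RΔ-solver.solve 2 (λ w y → w :- (y :+ (w :- y)) := con (+ 0)) RΔ.refl (ι W) (ι Y)
    where open RΔ-solver using (_:+_; _:-_; _:=_; con)

F : Series
F = gy -ₛ ŷ

F′ : F ′ ≋ gx ⋆ gz -ₛ 0ₛ
F′ = 𝕊.+-cong gy′ (𝕊.-‿cong (S.const-′ (ι Y)))

gy″ : gy ′ ′ ≋ (gx ⋆ gy) ⋆ gz +ₛ gx ⋆ (gz ⋆ (gy +ₛ (ŵ -ₛ ŷ)))
gy″ = 𝕊.trans (S.′-cong gy′) (𝕊.trans (S.′-leibniz gx gz)
        (𝕊.+-cong (𝕊.*-congʳ {gz} gx′) (𝕊.*-congˡ {gx} (𝕊.trans gz′ (𝕊.*-congˡ {gz} gw≋gy+ŵ-ŷ)))))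

riccati-defect : Series
riccati-defect = F ′ -ₛ (F ⋆ F +ₛ Â ⋆ F +ₛ x̂z)

riccati-defect′≋0 : riccati-defect ′ ≋ 0ₛ
riccati-defect′≋0 = begin
  F ′ ′ -ₛ ((F ⋆ F) ′ +ₛ (Â ⋆ F) ′ +ₛ x̂z ′)
    ≈⟨ 𝕊.+-cong (𝕊.+-cong gy″ (𝕊.-‿cong (S.′-cong (S.const-′ (ι Y)))))
                (𝕊.-‿cong (𝕊.+-cong (𝕊.+-cong
                  (𝕊.trans (S.′-leibniz F F) (𝕊.+-cong (𝕊.*-congʳ {F} F′) (𝕊.*-congˡ {F} F′)))
                  (𝕊.trans (S.′-leibniz Â F) (𝕊.+-cong (𝕊.*-congʳ {F} (S.const-′ A)) (𝕊.*-cong Â≋ŵ+ŷ F′))))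
                  (S.const-′ xz))) ⟩
  ((gx ⋆ gy) ⋆ gz +ₛ gx ⋆ (gz ⋆ (gy +ₛ (ŵ -ₛ ŷ))) -ₛ 0ₛ)
    -ₛ (((gx ⋆ gz -ₛ 0ₛ) ⋆ F +ₛ F ⋆ (gx ⋆ gz -ₛ 0ₛ)) +ₛ (0ₛ ⋆ F +ₛ (ŵ +ₛ ŷ) ⋆ (gx ⋆ gz -ₛ 0ₛ)) +ₛ 0ₛ)
    ≈⟨ 𝕊-solver.solve 5 (λ x y z w ŷ →
         ((x :* y) :* z :+ x :* (z :* (y :+ (w :- ŷ))) :- con (+ 0))
         :- (((x :* z :- con (+ 0)) :* (y :- ŷ) :+ (y :- ŷ) :* (x :* z :- con (+ 0)))
             :+ (con (+ 0) :* (y :- ŷ) :+ (w :+ ŷ) :* (x :* z :- con (+ 0))) :+ con (+ 0))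
         := con (+ 0)) 𝕊.refl gx gy gz ŵ ŷ ⟩
  0ₛ ∎
  where
  open import Relation.Binary.Reasoning.Setoid S.≋-setoid
  open 𝕊-solver using (_:+_; _:*_; _:-_; _:=_; con)

riccati-defect₀≈0 : riccati-defect 0 RΔ.≈ 0Δ
riccati-defect₀≈0 = begin
  ι (D Y) RΔ.- 0Δ RΔ.- ((F ⋆ F) 0 RΔ.+ (Â ⋆ F) 0 RΔ.+ xz)
    ≈⟨ RΔ.+-congˡ {ι (D Y) RΔ.- 0Δ} (RΔ.-‿cong (RΔ.+-congʳ {xz} (RΔ.+-cong (S.⋆-zero-index F F) (S.⋆-zero-index Â F)))) ⟩
  ι (D Y) RΔ.- 0Δ RΔ.- (F 0 RΔ.* F 0 RΔ.+ A RΔ.* F 0 RΔ.+ xz)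
    ≈⟨ RΔ-solver.solve 4 (λ u y a x → u :- con (+ 0) :- ((y :- y) :* (y :- y) :+ a :* (y :- y) :+ x) := u :- x)
                         RΔ.refl (ι (D Y)) (ι Y) A xz ⟩
  ι (D Y) RΔ.- xz
    ≈⟨ RΔ.trans (RΔ.+-congʳ {RΔ.- xz} (Q.embed-cong D-y)) (RΔ.-‿inverseʳ xz) ⟩
  0Δ ∎
  where
  open import Relation.Binary.Reasoning.Setoid RΔ.setoid
  open RΔ-solver using (_:+_; _:*_; _:-_; _:=_; con)

riccati : F ′ ≋ F ⋆ F +ₛ Â ⋆ F +ₛ x̂z
riccati = x∙y⁻¹≈ε⇒x≈y (F ′) (F ⋆ F +ₛ Â ⋆ F +ₛ x̂z) (S.′≋0⇒≋0 riccati-defect riccati-defect′≋0 riccati-defect₀≈0)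

E : Series
E = expΔ

E′ : E ′ ≋ Δ̂ ⋆ E
E′ = pointwise λ n → RΔ.sym (S.const-⋆ Δ E n)

constS≋const : ∀ x → constS x ≋ const x
constS≋const x = pointwise λ { zero → RΔ.refl ; (suc n) → RΔ.refl }

affine≋ : ∀ x y a → (constS x +S (y ·S a)) ≋ const x +ₛ const y ⋆ a
affine≋ x y a = pointwise λ n → RΔ.+-cong (S.at (constS≋const x) n) (RΔ.sym (S.const-⋆ y a n))

den num : Series
den = (Â +ₛ Δ̂) +ₛ -ₛ (Â -ₛ Δ̂) ⋆ E
num = -ₛ (2# ⋆ x̂z) +ₛ 2# ⋆ x̂z ⋆ E

c₁ c₂ : RΔ
c₁ = -Δ (A +Δ (-Δ Δ))
c₂ = natΔ 2 *Δ xz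

const-c₁ : const c₁ ≋ -ₛ (Â -ₛ Δ̂)
const-c₁ = 𝕊.trans (S.const-neg (A +Δ (-Δ Δ))) (𝕊.-‿cong (𝕊.trans (S.const-+ A (-Δ Δ)) (𝕊.+-congˡ (S.const-neg Δ))))

const-c₂ : const c₂ ≋ 2# ⋆ x̂z
const-c₂ = 𝕊.trans (S.const-* (natΔ 2) xz) (𝕊.*-congʳ {x̂z} (S.const-nat 2))

Den≋den : Den ≋ den
Den≋den = 𝕊.trans (affine≋ (A +Δ Δ) c₁ E) (𝕊.+-cong (S.const-+ A Δ) (𝕊.*-congʳ {E} const-c₁))

Den′ : Den ′ ≋ -ₛ (Â -ₛ Δ̂) ⋆ (Δ̂ ⋆ E)
Den′ = 𝕊.trans (S.′-cong (affine≋ (A +Δ Δ) c₁ E)) (𝕊.trans (S.affine-′ (A +Δ Δ) c₁ E) (𝕊.*-cong const-c₁ E′))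

Num≋num : Num ≋ num
Num≋num = 𝕊.trans (affine≋ (-Δ c₂) c₂ E) (𝕊.+-cong (𝕊.trans (S.const-neg c₂) (𝕊.-‿cong const-c₂)) (𝕊.*-congʳ {E} const-c₂))

Num′ : Num ′ ≋ 2# ⋆ x̂z ⋆ (Δ̂ ⋆ E)
Num′ = 𝕊.trans (S.′-cong (affine≋ (-Δ c₂) c₂ E)) (𝕊.trans (S.affine-′ (-Δ c₂) c₂ E) (𝕊.*-cong const-c₂ E′))

Δ*Δ : Δ *Δ Δ RΔ.≈ A *Δ A RΔ.- natΔ 4 *Δ xz
Δ*Δ = begin
  Δ *Δ Δ                                                 ≈⟨ Q.√d*√d ⟩
  ι disc                                                 ≈⟨ Q.embed-+ ((W ⊕ Y) ⊗ (W ⊕ Y)) (⊖ (cst (+ 4) ⊗ (X ⊗ Z))) ⟩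
  ι ((W ⊕ Y) ⊗ (W ⊕ Y)) +Δ ι (⊖ (cst (+ 4) ⊗ (X ⊗ Z)))   ≈⟨ RΔ.+-cong (Q.embed-* (W ⊕ Y) (W ⊕ Y))
                                                              (RΔ.trans (Q.embed-neg (cst (+ 4) ⊗ (X ⊗ Z))) (RΔ.-‿cong (Q.embed-* (cst (+ 4)) (X ⊗ Z)))) ⟩
  A *Δ A RΔ.- natΔ 4 *Δ xz                               ∎
  where open import Relation.Binary.Reasoning.Setoid RΔ.setoid

Δ̂² : Δ̂ ⋆ Δ̂ ≋ Â ⋆ Â -ₛ 4# ⋆ x̂z
Δ̂² = begin
  Δ̂ ⋆ Δ̂                                ≈⟨ S.const-* Δ Δ ⟨
  const (Δ *Δ Δ)                       ≈⟨ S.const-cong Δ*Δ ⟩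
  const (A *Δ A RΔ.- natΔ 4 *Δ xz)     ≈⟨ 𝕊.trans (S.const-+ (A *Δ A) _) (𝕊.+-cong (S.const-* A A) (S.const-neg (natΔ 4 *Δ xz))) ⟩
  Â ⋆ Â -ₛ const (natΔ 4 *Δ xz)        ≈⟨ 𝕊.+-congˡ {Â ⋆ Â} (𝕊.-‿cong (𝕊.trans (S.const-* (natΔ 4) xz) (𝕊.*-congʳ {x̂z} (S.const-nat 4)))) ⟩
  Â ⋆ Â -ₛ 4# ⋆ x̂z                     ∎
  where open import Relation.Binary.Reasoning.Setoid S.≋-setoid

P : Series
P = F ⋆ Den -ₛ Num

P-ode : const (natΔ 2) ⋆ P ′ ≋ (2# ⋆ F +ₛ Â +ₛ Δ̂) ⋆ P
P-ode = begin
  const (natΔ 2) ⋆ P ′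
    ≈⟨ 𝕊.*-cong (S.const-nat 2) (𝕊.+-cong (S.′-leibniz F Den) (𝕊.-‿cong Num′)) ⟩
  2# ⋆ (F ′ ⋆ Den +ₛ F ⋆ Den ′ -ₛ 2# ⋆ x̂z ⋆ (Δ̂ ⋆ E))
    ≈⟨ 𝕊.*-congˡ {2#} (𝕊.+-congʳ (𝕊.+-cong (𝕊.*-cong riccati Den≋den) (𝕊.*-congˡ {F} Den′))) ⟩
  2# ⋆ ((F ⋆ F +ₛ Â ⋆ F +ₛ x̂z) ⋆ den +ₛ F ⋆ (-ₛ (Â -ₛ Δ̂) ⋆ (Δ̂ ⋆ E)) -ₛ 2# ⋆ x̂z ⋆ (Δ̂ ⋆ E))
    ≈⟨ linearisation F E Â Δ̂ x̂z Δ̂² ⟩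
  (2# ⋆ F +ₛ Â +ₛ Δ̂) ⋆ (F ⋆ den -ₛ num)
    ≈⟨ 𝕊.*-congˡ {2# ⋆ F +ₛ Â +ₛ Δ̂} (𝕊.+-cong (𝕊.*-congˡ {F} Den≋den) (𝕊.-‿cong Num≋num)) ⟨
  (2# ⋆ F +ₛ Â +ₛ Δ̂) ⋆ P ∎
  where open import Relation.Binary.Reasoning.Setoid S.≋-setoid

P₀≈0 : P 0 RΔ.≈ 0Δ
P₀≈0 = begin
  (F ⋆ Den) 0 RΔ.- Num 0                                     ≈⟨ RΔ.+-congʳ (S.⋆-zero-index F Den) ⟩
  (ι Y RΔ.- ι Y) RΔ.* Den 0 RΔ.- (RΔ.- c₂ RΔ.+ c₂ RΔ.* RΔ.1#)
    ≈⟨ RΔ-solver.solve 3 (λ y d c → (y :- y) :* d :- (:- c :+ c :* con (+ 1)) := con (+ 0)) RΔ.refl (ι Y) (Den 0) c₂ ⟩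
  0Δ                                                          ∎
  where
  open import Relation.Binary.Reasoning.Setoid RΔ.setoid
  open RΔ-solver using (_:+_; _:*_; _:-_; :-_; _:=_; con)

natΔ-2*-cancel : ∀ u → natΔ 2 *Δ u RΔ.≈ 0Δ → u RΔ.≈ 0Δ
natΔ-2*-cancel (p , q) 2u≈0 = halve p (proj₁≈ u+u≈0) , halve q (proj₂≈ u+u≈0)
  where
  open Q using (proj₁≈; proj₂≈)
  natΔ-2 : natΔ 2 RΔ.≈ RΔ.1# RΔ.+ (RΔ.1# RΔ.+ 0Δ)
  natΔ-2 = RΔ.trans (natΔ-suc 1) (RΔ.+-congˡ {RΔ.1#} (RΔ.trans (natΔ-suc 0) (RΔ.+-congˡ {RΔ.1#} natΔ-0)))
  u+u≈0 : (p , q) +Δ (p , q) RΔ.≈ 0Δ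
  u+u≈0 = RΔ.trans (RΔ-solver.solve 1 (λ u → u :+ u := (con (+ 1) :+ (con (+ 1) :+ con (+ 0))) :* u) RΔ.refl (p , q))
                   (RΔ.trans (RΔ.*-congʳ {p , q} (RΔ.sym natΔ-2)) 2u≈0)
    where open RΔ-solver using (_:+_; _:*_; _:=_; con)
  halve : ∀ r → (r ⊕ r) ≃ [] → r ≃ []
  halve r r+r≃0 = coeffwise λ m → ℤ-halve (coeff r m) (≡.trans (≡.sym (coeff-⊕ r r m)) (coeffs r+r≃0 m))
    where
    ℤ-halve : ∀ i → i ℤ.+ i ≡ 0ℤ → i ≡ 0ℤ
    ℤ-halve (+ zero)   _ = ≡.refl
    ℤ-halve (+ suc n)  ()
    ℤ-halve -[1+ n ]   ()

P≋0 : P ≋ 0ₛ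
P≋0 = S.linear-ode-uniqueness (natΔ 2) natΔ-2*-cancel P (2# ⋆ F +ₛ Â +ₛ Δ̂) P-ode P₀≈0

GenY⋆Den≋ : GenY ⋆ Den ≋ ŷ ⋆ Den +ₛ Num
GenY⋆Den≋ = begin
  gy ⋆ Den                              ≈⟨ 𝕊-solver.solve 4 (λ g y d n → g :* d := (g :- y) :* d :- n :+ (y :* d :+ n)) 𝕊.refl gy ŷ Den Num ⟩
  P +ₛ (ŷ ⋆ Den +ₛ Num)                 ≈⟨ 𝕊.+-congʳ P≋0 ⟩
  0ₛ +ₛ (ŷ ⋆ Den +ₛ Num)                ≈⟨ 𝕊.+-identityˡ _ ⟩
  ŷ ⋆ Den +ₛ Num                        ∎
  where
  open import Relation.Binary.Reasoning.Setoid S.≋-setoid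
  open 𝕊-solver using (_:+_; _:*_; _:-_; _:=_)

≈²⇒≈Δ : ∀ {u v} → u RΔ.≈ v → u ≈Δ v
≈²⇒≈Δ (p≃p′ , q≃q′) = coeffs p≃p′ , coeffs q≃q′

theorem3p4 : (n : ℕ) → egfMul GenY Den n ≈Δ (egfMul (constS (ι Y)) Den n +Δ Num n)
theorem3p4 n = ≈²⇒≈Δ (begin
  (GenY ⋆ Den) n                    ≈⟨ S.at GenY⋆Den≋ n ⟩
  (ŷ ⋆ Den) n +Δ Num n              ≈⟨ RΔ.+-congʳ (S.at (S.⋆-cong {b = Den} (constS≋const (ι Y)) 𝕊.refl) n) ⟨
  (constS (ι Y) ⋆ Den) n +Δ Num n   ∎)
  where open import Relation.Binary.Reasoning.Setoid RΔ.setoid
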